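{- Let $m\in\mathbb{N}$. Then there is a bijection between the $m+m$ non-inclusive sum-and-distance systems and the $2m\times 2m$ principal reversible squares, and there is a bijection between the $m+m$ inclusive sum-and-distance systems and the $(2m+1)\times(2m+1)$ principal reversible squares.
   Context: $\mathbb{N}=\{1,2,3,\dots\}$. Given positive integers $a_1<a_2<\dots<a_m$ and $b_1<b_2<\dots<b_m$, the pair $\{\{a_j: 1\le j\le m\},\{b_j:1\le j\le m\}\}$ is called an $m+m$ (non-inclusive) sum-and-distance system if $\{a_j+b_k,\ |a_j-b_k| : j,k\in\{1,\dots,m\}\}=\{1,3,5,\dots,4m^2-1\}$, and an $m+m$ inclusive sum-and-distance system if $\{a_j,\ b_k,\ a_j+b_k,\ |a_j-b_k| : j,k\in\{1,\dots,m\}\}=\{1,2,3,\dots,2m(m+1)\}$. A reversible square matrix is an $n\times n$ real matrix $M=(M_{i,j})_{i,j\in\mathbb{Z}_n}$, indices taken in $\mathbb{Z}_n=\mathbb{Z}/n\mathbb{Z}$ with the top left entry having index $(1,1)$, such that (R) $M_{i,j}+M_{i,n+1-j}=M_{i,k}+M_{i,n+1-k}$ and $M_{i,j}+M_{n+1-i,j}=M_{k,j}+M_{n+1-k,j}$ for all $i,j,k\in\mathbb{Z}_n$, and (V) $M_{i,j}+M_{k,l}=M_{i,l}+M_{k,j}$ for all $i,j,k,l\in\mathbb{Z}_n$. An $n\times n$ principal reversible square is a reversible square matrix $M$ with $\{M_{i,j}\}=\{1,2,\dots,n^2\}$, whose entries in each row and in each column appear in increasing order, and with $M_{1,1}=1$,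 $M_{1,2}=2$. -}

module Defs where

open import Level using (0ℓ)
open import Data.Nat using (ℕ; zero; suc; _+_; _*_; _≤_; _<_; ∣_-_∣)
open import Data.Fin using (Fin; toℕ; opposite) renaming (_<_ to _<ᶠ_)
open import Data.Product using (Σ; ∃; ∃-syntax; _×_; _,_; proj₁; proj₂)
open import Data.Sum using (_⊎_; inj₁; inj₂)
open import Function.Bundles using (_⇔_)
open import Relation.Binary.Bundles using (Setoid)
open import Relation.Binary.Structures using (IsEquivalence)
open import Relation.Binary.PropositionalEquality using (_≡_; refl; sym; trans)

-- Finite sets {a_1 < ... < a_m} of positive integers, given by their
-- increasing enumeration a : Fin m → ℕ (a j = a_{j+1}).

StrictIncPos : (m : ℕ) → (Fin m → ℕ) → Set
StrictIncPos m a = (∀ j → 1 ≤ a j) × (∀ j j' → j <ᶠ j' → a j < a j')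

_≗ᵥ_ : ∀ {m} → (Fin m → ℕ) → (Fin m → ℕ) → Set
a ≗ᵥ a' = ∀ j → a j ≡ a' j

-- {1,3,5,...,4m²-1} = {2t+1 : 0 ≤ t < 2m²}
OddTarget : ℕ → ℕ → Set
OddTarget m v = ∃[ t ] (t < 2 * (m * m) × v ≡ suc (2 * t))

InclTarget : ℕ → ℕ → Set
InclTarget m v = 1 ≤ v × v ≤ 2 * (m * (m + 1))

SumDist : ∀ {m} → (Fin m → ℕ) → (Fin m → ℕ) → ℕ → Set
SumDist a b v = ∃[ j ] ∃[ k ] (v ≡ a j + b k ⊎ v ≡ ∣ a j - b k ∣)

InclSumDist : ∀ {m} → (Fin m → ℕ) → (Fin m → ℕ) → ℕ → Set
InclSumDist a b v = (∃[ j ] v ≡ a j) ⊎ (∃[ k ] v ≡ b k) ⊎ SumDist a b v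

-- Sum-and-distance systems.  The pair {A,B} is unordered; we store an
-- ordered pair (a , b) and identify (a , b) with (b , a) in the setoid.

record NonInclSADSys (m : ℕ) : Set where
  field
    a b   : Fin m → ℕ
    a-inc : StrictIncPos m a
    b-inc : StrictIncPos m b
    sad   : ∀ v → SumDist a b v ⇔ OddTarget m v

record InclSADSys (m : ℕ) : Set where
  field
    a b   : Fin m → ℕ
    a-inc : StrictIncPos m a
    b-inc : StrictIncPos m b
    sad   : ∀ v → InclSumDist a b v ⇔ InclTarget m v

UPairEq : ∀ {m} → (Fin m → ℕ) → (Fin m → ℕ) → (Fin m → ℕ) → (Fin m → ℕ) → Set
UPairEq a b a' b' = (a ≗ᵥ a' × b ≗ᵥ b') ⊎ (a ≗ᵥ b' × b ≗ᵥ a')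

private
  ≗-sym : ∀ {m} {a a' : Fin m → ℕ} → a ≗ᵥ a' → a' ≗ᵥ a
  ≗-sym p j = sym (p j)
  ≗-trans : ∀ {m} {a a' a'' : Fin m → ℕ} → a ≗ᵥ a' → a' ≗ᵥ a'' → a ≗ᵥ a''
  ≗-trans p q j = trans (p j) (q j)

  UPair-refl : ∀ {m} {a b : Fin m → ℕ} → UPairEq a b a b
  UPair-refl = inj₁ ((λ _ → refl) , (λ _ → refl))

  UPair-sym : ∀ {m} {a b a' b' : Fin m → ℕ} → UPairEq a b a' b' → UPairEq a' b' a b
  UPair-sym (inj₁ (p , q)) = inj₁ (≗-sym p , ≗-sym q)
  UPair-sym (inj₂ (p , q)) = inj₂ (≗-sym q , ≗-sym p)

  UPair-trans : ∀ {m} {a b a' b' a'' b'' : Fin m → ℕ} →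
                UPairEq a b a' b' → UPairEq a' b' a'' b'' → UPairEq a b a'' b''
  UPair-trans (inj₁ (p , q)) (inj₁ (r , s)) = inj₁ (≗-trans p r , ≗-trans q s)
  UPair-trans (inj₁ (p , q)) (inj₂ (r , s)) = inj₂ (≗-trans p r , ≗-trans q s)
  UPair-trans (inj₂ (p , q)) (inj₁ (r , s)) = inj₂ (≗-trans p s , ≗-trans q r)
  UPair-trans (inj₂ (p , q)) (inj₂ (r , s)) = inj₁ (≗-trans p s , ≗-trans q r)

NonInclSAD : ℕ → Setoid 0ℓ 0ℓ
NonInclSAD m = record
  { Carrier = NonInclSADSys m
  ; _≈_ = λ S T → UPairEq (NonInclSADSys.a S) (NonInclSADSys.b S)
                          (NonInclSADSys.a T) (NonInclSADSys.b T)
  ; isEquivalence = record { refl = UPair-refl ; sym = UPair-sym ; trans = UPair-trans }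
  }

InclSAD : ℕ → Setoid 0ℓ 0ℓ
InclSAD m = record
  { Carrier = InclSADSys m
  ; _≈_ = λ S T → UPairEq (InclSADSys.a S) (InclSADSys.b S)
                          (InclSADSys.a T) (InclSADSys.b T)
  ; isEquivalence = record { refl = UPair-refl ; sym = UPair-sym ; trans = UPair-trans }
  }

-- Reversible squares.  Index i : Fin n stands for row i+1; the index
-- n+1-(i+1) corresponds to opposite i = n-1-i.

Matrix : ℕ → Set
Matrix n = Fin n → Fin n → ℕ

Reversible : ∀ n → Matrix n → Set
Reversible n M =
  -- (R)
  (∀ i j k → M i j + M i (opposite j) ≡ M i k + M i (opposite k)) ×
  (∀ i j k → M i j + M (opposite i) j ≡ M k j + M (opposite k) j) ×
  -- (V)
  (∀ i j k l → M i j + M k l ≡ M i l + M k j)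

record PrincipalRevSquare (n : ℕ) : Set where
  field
    M          : Matrix n
    reversible : Reversible n M
    entries    : ∀ v → (∃[ i ] ∃[ j ] v ≡ M i j) ⇔ (1 ≤ v × v ≤ n * n)
    rows-inc   : ∀ i j j' → j <ᶠ j' → M i j < M i j'
    cols-inc   : ∀ j i i' → i <ᶠ i' → M i j < M i' j
    m11        : ∀ (i j : Fin n) → toℕ i ≡ 0 → toℕ j ≡ 0 → M i j ≡ 1
    m12        : ∀ (i j : Fin n) → toℕ i ≡ 0 → toℕ j ≡ 1 → M i j ≡ 2

PRS : ℕ → Setoid 0ℓ 0ℓ
PRS n = record
  { Carrier = PrincipalRevSquare n
  ; _≈_ = λ S T → ∀ i j → PrincipalRevSquare.M S i j ≡ PrincipalRevSquare.M T i j
  ; isEquivalence = record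
      { refl = λ _ _ → refl
      ; sym = λ p i j → sym (p i j)
      ; trans = λ p q i j → trans (p i j) (q i j) }
  }

-- Sort each set increasingly, a_1 < … < a_m, and place the signed values
-- −a_m < … < −a_1 < a_1 < … < a_m (with a 0 in the middle when n = 2m+1)
-- along an axis of length n.  Shifting by a_m (and halving in the even case,
-- which is possible because every a_j + b_k is odd) turns this into a row
-- sequence r of naturals with r_1 = 0 and r_i + r_{n+1-i} constant; the
-- column sequence c comes from b in the same way, and M_ij = r_i + c_j + 1.
-- Condition (V) says precisely that a matrix is such an outer sum, and (R)
-- that r and c have constant opposite sums.  Up to an affine change of
-- variable the entries of M are the sums s_i + t_j of signed values, i.e.
-- 0, ±a_j, ±b_k, ±(a_j + b_k), ±|a_j − b_k|, so "M has entries 1, …, n²"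
-- is the sum-and-distance property.  Transposing M swaps the roles of the
-- two sets; the normalisation M_{1,2} = 2 picks one of the two squares.
module Submission where

open import Defs
open import Data.Nat using (ℕ; suc; _*_; _≤_)
open import Data.Product using (_×_)
open import Function.Bundles using (Bijection)

open import Level using (0ℓ)
open import Data.Nat as ℕ using (zero; _+_; _∸_; _<_; ∣_-_∣; z≤n; s≤s; _≟_; ⌊_/2⌋)
import Data.Nat.Properties as NP
open import Data.Fin as F using (Fin; toℕ; fromℕ<; opposite; combine; remQuot; punchOut) renaming (_<_ to _<ᶠ_)
open import Data.Fin.Properties as FP using (toℕ-injective; toℕ-fromℕ<; punchOut-injective; remQuot-combine)
open import Data.Product using (Σ; ∃; ∃-syntax; _,_; proj₁; proj₂; swap)
open import Data.Sum using (_⊎_; inj₁; inj₂)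
open import Data.Empty using (⊥; ⊥-elim)
open import Relation.Nullary using (¬_; Dec; yes; no)
open import Relation.Binary.Definitions using (tri<; tri≈; tri>)
open import Relation.Binary.PropositionalEquality using (_≡_; _≢_; refl; sym; trans; cong; cong₂; subst; subst₂; module ≡-Reasoning)
open import Function.Bundles using (_⇔_; mk⇔; Equivalence)
open import Relation.Binary.Bundles using (Setoid)
open import Data.Nat.Tactic.RingSolver using (solve-∀)

Fin-section⇒injective : ∀ {K} (f g : Fin K → Fin K) → (∀ y → f (g y) ≡ y) →
                        ∀ p q → f p ≡ f q → p ≡ q
Fin-section⇒injective {zero} f g fg () q e
Fin-section⇒injective {suc K} f g fg p q e with p F.≟ q
... | yes p≡q = p≡q
... | no p≢q = ⊥-elim (NP.1+n≰n (FP.injective⇒≤ punched-injective))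
  where
  g-injective : ∀ {y y'} → g y ≡ g y' → y ≡ y'
  g-injective {y} {y'} h = trans (sym (fg y)) (trans (cong f h) (fg y'))

  -- g (f p) = g (f q) is at most one of p ≢ q, and g misses the other one.
  missed : Σ (Fin (suc K)) λ x → ∀ y → g y ≢ x
  missed with g (f p) F.≟ p
  ... | yes gfp≡p = q , λ y gy≡q → p≢q (trans (sym gfp≡p)
          (trans (cong g (trans e (trans (cong f (sym gy≡q)) (fg y)))) gy≡q))
  ... | no gfp≢p = p , λ y gy≡p → gfp≢p (trans (cong g (trans (cong f (sym gy≡p)) (fg y))) gy≡p)

  punched : Fin (suc K) → Fin K
  punched y = punchOut {i = proj₁ missed} {j = g y} (λ h → proj₂ missed y (sym h))

  punched-injective : ∀ {y y'} → punched y ≡ punched y' → y ≡ y'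
  punched-injective h = g-injective (punchOut-injective {i = proj₁ missed} _ _ h)

HasEntries : ∀ {n} → Matrix n → (ℕ → Set) → Set
HasEntries M V = ∀ v → (∃[ i ] ∃[ j ] v ≡ M i j) ⇔ V v

hasEntries-cong : ∀ {n} {M M' : Matrix n} {V} → (∀ i j → M i j ≡ M' i j) → HasEntries M V → HasEntries M' V
hasEntries-cong M≗M' E v = mk⇔
  (λ { (i , j , e) → Equivalence.to (E v) (i , j , trans e (sym (M≗M' i j))) })
  (λ x → let (i , j , e) = Equivalence.from (E v) x in i , j , trans e (M≗M' i j))

-- (i , j) ↦ M i j − 1 is a surjective endomap of Fin (n * n), hence injective.
entries-injective : ∀ {n} (M : Matrix n) → HasEntries M (λ v → 1 ≤ v × v ≤ n * n) →
                    ∀ i j i' j' → M i j ≡ M i' j' → i ≡ i' × j ≡ j'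
entries-injective {n} M entries i j i' j' e = cong proj₁ same-position , cong proj₂ same-position
  where
  bounds : ∀ i j → 1 ≤ M i j × M i j ≤ n * n
  bounds i j = Equivalence.to (entries (M i j)) (i , j , refl)

  pred< : ∀ v → 1 ≤ v → v ≤ n * n → ℕ.pred v < n * n
  pred< (suc v) _ v<n*n = v<n*n

  position : Fin n × Fin n → Fin (n * n)
  position (i , j) = fromℕ< (pred< (M i j) (proj₁ (bounds i j)) (proj₂ (bounds i j)))

  toℕ-position : ∀ i j → toℕ (position (i , j)) ≡ ℕ.pred (M i j)
  toℕ-position i j = toℕ-fromℕ< _

  f : Fin (n * n) → Fin (n * n)
  f x = position (remQuot n x)

  preimage : (y : Fin (n * n)) → ∃[ i ] ∃[ j ] suc (toℕ y) ≡ M i j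
  preimage y = Equivalence.from (entries (suc (toℕ y))) (s≤s z≤n , FP.toℕ<n y)

  g : Fin (n * n) → Fin (n * n)
  g y = combine (proj₁ (preimage y)) (proj₁ (proj₂ (preimage y)))

  f∘g≗id : ∀ y → f (g y) ≡ y
  f∘g≗id y with preimage y
  ... | i , j , e = trans (cong position (remQuot-combine i j))
                      (toℕ-injective (trans (toℕ-position i j) (cong ℕ.pred (sym e))))

  same-combine : combine i j ≡ combine i' j'
  same-combine = Fin-section⇒injective f g f∘g≗id _ _
    (trans (cong position (remQuot-combine i j))
      (trans (toℕ-injective (trans (toℕ-position i j) (trans (cong ℕ.pred e) (sym (toℕ-position i' j')))))
        (sym (cong position (remQuot-combine i' j')))))

  same-position : (i , j) ≡ (i' , j')
  same-position = trans (sym (remQuot-combine i j))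
                    (trans (cong (remQuot n) same-combine) (remQuot-combine i' j'))

-- Outer sums

OuterSum : ∀ {n} → (Fin n → ℕ) → (Fin n → ℕ) → Matrix n
OuterSum r c i j = r i + c j + 1

ConstantOppositeSums : ∀ {n} → (Fin n → ℕ) → Set
ConstantOppositeSums r = ∀ i k → r i + r (opposite i) ≡ r k + r (opposite k)

outerSum-reversible : ∀ {n} {r c : Fin n → ℕ} → ConstantOppositeSums r → ConstantOppositeSums c →
                      Reversible n (OuterSum r c)
outerSum-reversible {r = r} {c} r-sums c-sums = rows , columns , vertices
  where
  row-identity : ∀ x y z → (x + y + 1) + (x + z + 1) ≡ (y + z) + (x + x + 2)
  row-identity = solve-∀
  column-identity : ∀ x y z → (x + y + 1) + (z + y + 1) ≡ (x + z) + (y + y + 2)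
  column-identity = solve-∀
  vertex-identity : ∀ x y z w → (x + y + 1) + (z + w + 1) ≡ (x + w + 1) + (z + y + 1)
  vertex-identity = solve-∀

  rows : ∀ i j k → OuterSum r c i j + OuterSum r c i (opposite j) ≡ OuterSum r c i k + OuterSum r c i (opposite k)
  rows i j k = trans (row-identity (r i) (c j) (c (opposite j)))
                 (trans (cong (_+ (r i + r i + 2)) (c-sums j k))
                   (sym (row-identity (r i) (c k) (c (opposite k)))))
  columns : ∀ i j k → OuterSum r c i j + OuterSum r c (opposite i) j ≡ OuterSum r c k j + OuterSum r c (opposite k) j
  columns i j k = trans (column-identity (r i) (c j) (r (opposite i)))
                    (trans (cong (_+ (c j + c j + 2)) (r-sums i k))
                      (sym (column-identity (r k) (c j) (r (opposite k)))))
  vertices : ∀ i j k l → OuterSum r c i j + OuterSum r c k l ≡ OuterSum r c i l + OuterSum r c k j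
  vertices i j k l = vertex-identity (r i) (c j) (r k) (c l)

outerSum-transpose-entries : ∀ {n} (r c : Fin n → ℕ) {V : ℕ → Set} →
                             HasEntries (OuterSum r c) V → HasEntries (OuterSum c r) V
outerSum-transpose-entries r c E v = mk⇔
  (λ { (i , j , e) → Equivalence.to (E v) (j , i , trans e (cong (_+ 1) (NP.+-comm (c i) (r j)))) })
  (λ x → let (i , j , e) = Equivalence.from (E v) x in
         j , i , trans e (cong (_+ 1) (NP.+-comm (r i) (c j))))

+-double-injective : ∀ x y → x + x ≡ y + y → x ≡ y
+-double-injective zero zero e = refl
+-double-injective (suc x) (suc y) e =
  cong suc (+-double-injective x y (NP.suc-injective (trans (sym (NP.+-suc x x))
    (trans (NP.suc-injective e) (NP.+-suc y y)))))

double-cancel-≤ : ∀ x y → x + x ≤ y + y → x ≤ y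
double-cancel-≤ x y le with x ℕ.≤? y
... | yes x≤y = x≤y
... | no x≰y = ⊥-elim (NP.≤⇒≯ le (NP.+-mono-< (NP.≰⇒> x≰y) (NP.≰⇒> x≰y)))

double-cancel-< : ∀ x y → x + x < y + y → x < y
double-cancel-< x y lt with x ℕ.<? y
... | yes x<y = x<y
... | no x≮y = ⊥-elim (NP.≤⇒≯ (NP.+-mono-≤ (NP.≮⇒≥ x≮y) (NP.≮⇒≥ x≮y)) lt)

∸-mono-< : ∀ {x x' y y'} → x < x' → y' < y → y ≤ x → x ∸ y < x' ∸ y'
∸-mono-< {y' = y'} x<x' y'<y y≤x = NP.<-≤-trans (NP.∸-monoʳ-< y'<y y≤x) (NP.∸-monoˡ-≤ y' (NP.<⇒≤ x<x'))

2*≡double : ∀ t → 2 * t ≡ t + t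
2*≡double = solve-∀

IsEven IsOdd : ℕ → Set
IsEven x = ∃[ h ] x ≡ h + h
IsOdd x = ∃[ h ] x ≡ suc (h + h)

even⊎odd : ∀ x → IsEven x ⊎ IsOdd x
even⊎odd zero = inj₁ (0 , refl)
even⊎odd (suc x) with even⊎odd x
... | inj₁ (h , e) = inj₂ (h , cong suc e)
... | inj₂ (h , e) = inj₁ (suc h , trans (cong suc e) (cong suc (sym (NP.+-suc h h))))

¬even∧odd : ∀ {x} → IsEven x → IsOdd x → ⊥
¬even∧odd (h , e) (k , e') = go h k (trans (sym e) e')
  where
  go : ∀ h k → h + h ≡ suc (k + k) → ⊥
  go (suc h) zero e with trans (sym (NP.+-suc h h)) (NP.suc-injective e)
  ... | ()
  go (suc h) (suc k) e = go h k (NP.suc-injective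
    (trans (sym (NP.+-suc h h)) (trans (NP.suc-injective e) (cong suc (NP.+-suc k k)))))

even+even : ∀ {x y} → IsEven x → IsEven y → IsEven (x + y)
even+even (h , refl) (k , refl) = h + k , rearrange h k
  where rearrange : ∀ h k → h + h + (k + k) ≡ h + k + (h + k)
        rearrange = solve-∀

odd+odd : ∀ {x y} → IsOdd x → IsOdd y → IsEven (x + y)
odd+odd (h , refl) (k , refl) = suc (h + k) , rearrange h k
  where rearrange : ∀ h k → suc (h + h) + suc (k + k) ≡ suc (h + k) + suc (h + k)
        rearrange = solve-∀

odd-1+2* : ∀ t → IsOdd (suc (2 * t))
odd-1+2* t = t , cong suc (2*≡double t)

odd-sums⇒even : ∀ x y z → IsOdd (z + x) → IsOdd (z + y) → IsEven (x + y)
odd-sums⇒even x y z z+x-odd z+y-odd with even⊎odd x | even⊎odd y | even⊎odd z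
... | inj₁ x-even | inj₁ y-even | _ = even+even x-even y-even
... | inj₂ x-odd  | inj₂ y-odd  | _ = odd+odd x-odd y-odd
... | inj₁ x-even | inj₂ _      | inj₁ z-even = ⊥-elim (¬even∧odd (even+even z-even x-even) z+x-odd)
... | inj₁ _      | inj₂ y-odd  | inj₂ z-odd  = ⊥-elim (¬even∧odd (odd+odd z-odd y-odd) z+y-odd)
... | inj₂ _      | inj₁ y-even | inj₁ z-even = ⊥-elim (¬even∧odd (even+even z-even y-even) z+y-odd)
... | inj₂ x-odd  | inj₁ _      | inj₂ z-odd  = ⊥-elim (¬even∧odd (odd+odd z-odd x-odd) z+x-odd)

∣-∣-cases : ∀ x y → (x ≡ y + ∣ x - y ∣) ⊎ (y ≡ x + ∣ x - y ∣)
∣-∣-cases x y with NP.≤-total y x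
... | inj₁ y≤x = inj₁ (trans (sym (NP.m+[n∸m]≡n y≤x)) (cong (y +_) (sym (NP.m≤n⇒∣n-m∣≡n∸m y≤x))))
... | inj₂ x≤y = inj₂ (trans (sym (NP.m+[n∸m]≡n x≤y)) (cong (x +_) (sym (NP.m≤n⇒∣m-n∣≡n∸m x≤y))))

∣-∣≡⇒cases : ∀ x y o → ∣ x - y ∣ ≡ o → (x ≡ y + o) ⊎ (y ≡ x + o)
∣-∣≡⇒cases x y o refl = ∣-∣-cases x y

m+n≡1⇒ : ∀ x y → x + y ≡ 1 → (x ≡ 0 × y ≡ 1) ⊎ (x ≡ 1 × y ≡ 0)
m+n≡1⇒ zero y e = inj₁ (refl , e)
m+n≡1⇒ (suc zero) zero e = inj₂ (refl , refl)
m+n≡1⇒ (suc zero) (suc y) ()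
m+n≡1⇒ (suc (suc x)) y ()

above-shift : ∀ K X x y o → X + y ≡ K + x → x ≡ y + o → X ≡ K + o
above-shift K X x y o e refl = NP.+-cancelʳ-≡ y _ _ (trans e (rearrange K y o))
  where rearrange : ∀ K y o → K + (y + o) ≡ K + o + y
        rearrange = solve-∀

below-shift : ∀ K X x y o → X + x ≡ K + y → x ≡ y + o → X + o ≡ K
below-shift K X x y o e refl = NP.+-cancelʳ-≡ y _ _ (trans (rearrange X y o) e)
  where rearrange : ∀ X y o → X + o + y ≡ X + (y + o)
        rearrange = solve-∀

∣-∣-shift : ∀ K X x y → X + y ≡ K + x → (X ≡ K + ∣ x - y ∣) ⊎ (X + ∣ x - y ∣ ≡ K)
∣-∣-shift K X x y e with ∣-∣-cases x y
... | inj₁ x≡y+d = inj₁ (above-shift K X x y _ e x≡y+d)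
... | inj₂ y≡x+d = inj₂ (below-shift K X y x _ e y≡x+d)

Increasing : ∀ {n} → (Fin n → ℕ) → Set
Increasing f = ∀ i i' → i <ᶠ i' → f i < f i'

increasing⇒≤last : ∀ {p} (a : Fin (suc p) → ℕ) → Increasing a → ∀ k → a k ≤ a (F.fromℕ p)
increasing⇒≤last {p} a a-increasing k with k F.≟ F.fromℕ p
... | yes refl = NP.≤-refl
... | no k≢last = NP.<⇒≤ (a-increasing k (F.fromℕ p) (NP.≤∧≢⇒< (FP.≤fromℕ k) (λ h → k≢last (toℕ-injective h))))

increasing⇒mono-≤ : ∀ {n} (f : Fin n → ℕ) → Increasing f → ∀ i i' → toℕ i ≤ toℕ i' → f i ≤ f i'
increasing⇒mono-≤ f f-increasing i i' le with i F.≟ i'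
... | yes refl = NP.≤-refl
... | no i≢i' = NP.<⇒≤ (f-increasing i i' (NP.≤∧≢⇒< le (λ h → i≢i' (toℕ-injective h))))

sumDist≤largest : ∀ {p} {a b : Fin (suc p) → ℕ} → Increasing a → Increasing b →
                  ∀ {v} → SumDist a b v → v ≤ a (F.fromℕ p) + b (F.fromℕ p)
sumDist≤largest {a = a} {b} a-increasing b-increasing (j , k , v≡) = bound v≡
  where
  sum≤ : a j + b k ≤ a (F.fromℕ _) + b (F.fromℕ _)
  sum≤ = NP.+-mono-≤ (increasing⇒≤last a a-increasing j) (increasing⇒≤last b b-increasing k)
  bound : ∀ {v} → v ≡ a j + b k ⊎ v ≡ ∣ a j - b k ∣ → v ≤ a (F.fromℕ _) + b (F.fromℕ _)
  bound (inj₁ refl) = sum≤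
  bound (inj₂ refl) = NP.≤-trans (NP.∣m-n∣≤m⊔n (a j) (b k)) (NP.≤-trans (NP.m⊔n≤m+n (a j) (b k)) sum≤)

pred-opposite-sum : ∀ {n} (g : Fin n → ℕ) (i0 : Fin n) → (∀ i → 1 ≤ g i) → g i0 ≡ 1 →
                    ConstantOppositeSums g →
                    ∀ i → (g i ∸ 1) + (g (opposite i) ∸ 1) ≡ g (opposite i0) ∸ 1
pred-opposite-sum g i0 positive g-i0 sums i = NP.+-cancelʳ-≡ 2 _ _ (begin
  (g i ∸ 1) + (g (opposite i) ∸ 1) + 2       ≡⟨ regroup (g i ∸ 1) (g (opposite i) ∸ 1) ⟩
  (g i ∸ 1 + 1) + (g (opposite i) ∸ 1 + 1)   ≡⟨ cong₂ _+_ (pred+1 i) (pred+1 (opposite i)) ⟩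
  g i + g (opposite i)                       ≡⟨ sums i i0 ⟩
  g i0 + g (opposite i0)                     ≡⟨ cong (λ z → z + g (opposite i0)) g-i0 ⟩
  1 + g (opposite i0)                        ≡⟨ cong (1 +_) (sym (pred+1 (opposite i0))) ⟩
  1 + (g (opposite i0) ∸ 1 + 1)              ≡⟨ shift (g (opposite i0) ∸ 1) ⟩
  (g (opposite i0) ∸ 1) + 2                  ∎)
  where
  open ≡-Reasoning
  pred+1 : ∀ i → g i ∸ 1 + 1 ≡ g i
  pred+1 i = NP.m∸n+n≡m (positive i)
  regroup : ∀ x y → x + y + 2 ≡ (x + 1) + (y + 1)
  regroup = solve-∀
  shift : ∀ x → 1 + (x + 1) ≡ x + 2
  shift = solve-∀

-- Condition (V) makes a square the outer sum of its first column and first row.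
module Offsets {n : ℕ} (X : PrincipalRevSquare n) (i0 : Fin n) (toℕ-i0 : toℕ i0 ≡ 0) where
  open PrincipalRevSquare X

  L : Fin n
  L = opposite i0

  bounds : ∀ i j → 1 ≤ M i j × M i j ≤ n * n
  bounds i j = Equivalence.to (entries (M i j)) (i , j , refl)

  M00 : M i0 i0 ≡ 1
  M00 = m11 i0 i0 toℕ-i0 toℕ-i0

  r c : Fin n → ℕ
  r i = M i i0 ∸ 1
  c j = M i0 j ∸ 1

  r+1 : ∀ i → r i + 1 ≡ M i i0
  r+1 i = NP.m∸n+n≡m (proj₁ (bounds i i0))

  c+1 : ∀ j → c j + 1 ≡ M i0 j
  c+1 j = NP.m∸n+n≡m (proj₁ (bounds i0 j))

  M≡OuterSum : ∀ i j → M i j ≡ OuterSum r c i j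
  M≡OuterSum i j = NP.+-cancelʳ-≡ 1 _ _ (begin
    M i j + 1                  ≡⟨ cong (M i j +_) (sym M00) ⟩
    M i j + M i0 i0            ≡⟨ proj₂ (proj₂ reversible) i j i0 i0 ⟩
    M i i0 + M i0 j            ≡⟨ cong₂ _+_ (sym (r+1 i)) (sym (c+1 j)) ⟩
    (r i + 1) + (c j + 1)      ≡⟨ regroup (r i) (c j) ⟩
    r i + c j + 1 + 1          ∎)
    where
    open ≡-Reasoning
    regroup : ∀ x y → x + 1 + (y + 1) ≡ x + y + 1 + 1
    regroup = solve-∀

  r-increasing : Increasing r
  r-increasing i i' lt = NP.+-cancelʳ-< 1 _ _ (subst₂ _<_ (sym (r+1 i)) (sym (r+1 i')) (cols-inc i0 i i' lt))

  c-increasing : Increasing c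
  c-increasing j j' lt = NP.+-cancelʳ-< 1 _ _ (subst₂ _<_ (sym (c+1 j)) (sym (c+1 j')) (rows-inc i0 j j' lt))

  r-i0 : r i0 ≡ 0
  r-i0 = cong (_∸ 1) M00

  c-i0 : c i0 ≡ 0
  c-i0 = cong (_∸ 1) M00

  r-opposite-sum : ∀ i → r i + r (opposite i) ≡ r L
  r-opposite-sum = pred-opposite-sum (λ i → M i i0) i0 (λ i → proj₁ (bounds i i0)) M00
                     (λ i k → proj₁ (proj₂ reversible) i i0 k)

  c-opposite-sum : ∀ j → c j + c (opposite j) ≡ c L
  c-opposite-sum = pred-opposite-sum (M i0) i0 (λ j → proj₁ (bounds i0 j)) M00
                     (λ j k → proj₁ reversible i0 j k)

  ≤L : ∀ (i : Fin n) → toℕ i ≤ toℕ L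
  ≤L i = subst (toℕ i ≤_) (sym (trans (FP.opposite-prop i0) (cong (λ z → n ∸ suc z) toℕ-i0)))
           (NP.∸-monoˡ-≤ 1 (FP.toℕ<n i))

  -- n * n is some entry M i j, and M i j ≤ M L L ≤ n * n by monotonicity.
  r+c-last : r L + c L + 1 ≡ n * n
  r+c-last with Equivalence.from (entries (n * n)) (subst (_≤ n * n) M00 (proj₂ (bounds i0 i0)) , NP.≤-refl)
  ... | i , j , e = NP.≤-antisym (subst (_≤ n * n) (M≡OuterSum L L) (proj₂ (bounds L L)))
        (subst₂ _≤_ (sym e) (M≡OuterSum L L)
          (NP.≤-trans (increasing⇒mono-≤ (M i) (rows-inc i) j L (≤L j))
                      (increasing⇒mono-≤ (λ i → M i L) (cols-inc L) i L (≤L i))))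

-- From systems to squares

module OuterSumBijection
  (n m : ℕ) (i0 i1 : Fin n) (toℕ-i0 : toℕ i0 ≡ 0) (toℕ-i1 : toℕ i1 ≡ 1) (2≤n*n : 2 ≤ n * n)
  (Sys : Setoid 0ℓ 0ℓ)
  (first second : Setoid.Carrier Sys → Fin m → ℕ)
  (≈⇒ : ∀ {S T} → Setoid._≈_ Sys S T → UPairEq (first S) (second S) (first T) (second T))
  (⇒≈ : ∀ {S T} → UPairEq (first S) (second S) (first T) (second T) → Setoid._≈_ Sys S T)
  (embed : (Fin m → ℕ) → Fin n → ℕ)
  (embed-cong : ∀ {a a'} → a ≗ᵥ a' → ∀ i → embed a i ≡ embed a' i)
  (embed-i0 : ∀ a → embed a i0 ≡ 0)
  (Good : (Fin m → ℕ) → Set)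
  (first-good : ∀ S → Good (first S)) (second-good : ∀ S → Good (second S))
  (embed-injective : ∀ {a a'} → Good a → Good a' → (∀ i → embed a i ≡ embed a' i) → a ≗ᵥ a')
  (embed-increasing : ∀ {a} → Good a → Increasing (embed a))
  (embed-sums : ∀ {a} → Good a → ConstantOppositeSums (embed a))
  (system-entries : ∀ S → HasEntries (OuterSum (embed (first S)) (embed (second S))) (λ v → 1 ≤ v × v ≤ n * n))
  (decode : ∀ (X : PrincipalRevSquare n) → Σ (Setoid.Carrier Sys) λ S →
     embed (second S) i1 ≡ 1 × (∀ i j → OuterSum (embed (first S)) (embed (second S)) i j ≡ PrincipalRevSquare.M X i j))
  where

  open Setoid Sys using (Carrier; _≈_)
  open PrincipalRevSquare using (M)

  Square : (Fin m → ℕ) → (Fin m → ℕ) → Matrix n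
  Square a b = OuterSum (embed a) (embed b)

  -- M_{1,2} = 2 says that the column set is the one whose embedding takes the value 1 at index 1.
  Oriented : (Fin m → ℕ) → Set
  Oriented b = embed b i1 ≡ 1

  toℕ⇒≡i0 : ∀ i → toℕ i ≡ 0 → i ≡ i0
  toℕ⇒≡i0 i e = toℕ-injective (trans e (sym toℕ-i0))

  toℕ⇒≡i1 : ∀ i → toℕ i ≡ 1 → i ≡ i1
  toℕ⇒≡i1 i e = toℕ-injective (trans e (sym toℕ-i1))

  principalSquare : ∀ a b → Good a → Good b →
                    HasEntries (Square a b) (λ v → 1 ≤ v × v ≤ n * n) →
                    Oriented b → PrincipalRevSquare n
  principalSquare a b a-good b-good square-entries b-oriented = record
    { M = Square a b
    ; reversible = outerSum-reversible {r = embed a} {embed b} (embed-sums a-good) (embed-sums b-good)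
    ; entries = square-entries
    ; rows-inc = λ i j j' lt → NP.+-monoˡ-< 1 (NP.+-monoʳ-< (embed a i) (embed-increasing b-good j j' lt))
    ; cols-inc = λ j i i' lt → NP.+-monoˡ-< 1 (NP.+-monoˡ-< (embed b j) (embed-increasing a-good i i' lt))
    ; m11 = λ i j ei ej → cong₂ (λ x y → x + y + 1) (trans (cong (embed a) (toℕ⇒≡i0 i ei)) (embed-i0 a))
                                                    (trans (cong (embed b) (toℕ⇒≡i0 j ej)) (embed-i0 b))
    ; m12 = λ i j ei ej → cong₂ (λ x y → x + y + 1) (trans (cong (embed a) (toℕ⇒≡i0 i ei)) (embed-i0 a))
                                                    (trans (cong (embed b) (toℕ⇒≡i1 j ej)) b-oriented)
    }

  i0<i1 : i0 <ᶠ i1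
  i0<i1 rewrite toℕ-i0 | toℕ-i1 = s≤s z≤n

  value-1⇒oriented : ∀ {a} → Good a → ∀ j → embed a j ≡ 1 → Oriented a
  value-1⇒oriented {a} a-good j e with toℕ j in toℕ-j
  ... | zero = ⊥-elim (0≢1 (trans (sym (embed-i0 a)) (trans (cong (embed a) (sym (toℕ⇒≡i0 j toℕ-j))) e)))
    where 0≢1 : 0 ≢ 1
          0≢1 ()
  ... | suc zero = trans (cong (embed a) (sym (toℕ⇒≡i1 j toℕ-j))) e
  ... | suc (suc _) = ⊥-elim (NP.<-irrefl refl (NP.≤-trans 1<embed (NP.≤-reflexive e)))
    where
    i1<j : i1 <ᶠ j
    i1<j rewrite toℕ-i1 | toℕ-j = s≤s (s≤s z≤n)
    1<embed : 1 < embed a j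
    1<embed = NP.≤-<-trans (subst (_≤ embed a i1) (cong suc (embed-i0 a)) (embed-increasing a-good i0 i1 i0<i1))
                (embed-increasing a-good i1 j i1<j)

  -- The entry 2 = embed a i + embed b j + 1 forces one of the two values to be 1.
  oriented-other : ∀ S → ¬ Oriented (second S) → Oriented (first S)
  oriented-other S ¬oriented with Equivalence.from (system-entries S 2) (s≤s z≤n , 2≤n*n)
  ... | i , j , e with m+n≡1⇒ (embed (first S) i) (embed (second S) j) (NP.+-cancelʳ-≡ _ _ 1 (sym e))
  ... | inj₁ (_ , e1) = ⊥-elim (¬oriented (value-1⇒oriented (second-good S) j e1))
  ... | inj₂ (e1 , _) = value-1⇒oriented (first-good S) i e1

  ¬both-oriented : ∀ S → Oriented (first S) → Oriented (second S) → ⊥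
  ¬both-oriented S first-oriented second-oriented = i1≢i0 (proj₁ (entries-injective _ (system-entries S) i1 i0 i0 i1 M10≡M01))
    where
    M10≡M01 : Square (first S) (second S) i1 i0 ≡ Square (first S) (second S) i0 i1
    M10≡M01 = trans (cong₂ (λ x y → x + y + 1) first-oriented (embed-i0 (second S)))
                    (sym (cong₂ (λ x y → x + y + 1) (embed-i0 (first S)) second-oriented))
    i1≢i0 : i1 ≢ i0
    i1≢i0 h with trans (sym toℕ-i1) (trans (cong toℕ h) toℕ-i0)
    ... | ()

  toSquare-cases : ∀ S → Dec (Oriented (second S)) → PrincipalRevSquare n
  toSquare-cases S (yes oriented) =
    principalSquare (first S) (second S) (first-good S) (second-good S) (system-entries S) oriented
  toSquare-cases S (no ¬oriented) =
    principalSquare (second S) (first S) (second-good S) (first-good S)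
      (outerSum-transpose-entries (embed (first S)) (embed (second S)) (system-entries S)) (oriented-other S ¬oriented)

  toSquare : Carrier → PrincipalRevSquare n
  toSquare S = toSquare-cases S (embed (second S) i1 ≟ 1)

  toSquare-oriented : ∀ S → Oriented (second S) → ∀ i j → M (toSquare S) i j ≡ Square (first S) (second S) i j
  toSquare-oriented S = go (embed (second S) i1 ≟ 1)
    where
    go : ∀ d → Oriented (second S) → ∀ i j → M (toSquare-cases S d) i j ≡ Square (first S) (second S) i j
    go (yes _) _ i j = refl
    go (no ¬oriented) oriented = ⊥-elim (¬oriented oriented)

  toSquare-transposed : ∀ S → Oriented (first S) → ∀ i j → M (toSquare S) i j ≡ Square (second S) (first S) i j
  toSquare-transposed S = go (embed (second S) i1 ≟ 1)
    where
    go : ∀ d → Oriented (first S) → ∀ i j → M (toSquare-cases S d) i j ≡ Square (second S) (first S) i j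
    go (yes oriented) first-oriented = ⊥-elim (¬both-oriented S first-oriented oriented)
    go (no _) _ i j = refl

  Square-cong : ∀ {a a' b b'} → a ≗ᵥ a' → b ≗ᵥ b' → ∀ i j → Square a b i j ≡ Square a' b' i j
  Square-cong ea eb i j = cong₂ (λ x y → x + y + 1) (embed-cong ea i) (embed-cong eb j)

  Oriented-cong : ∀ {a a'} → a ≗ᵥ a' → Oriented a → Oriented a'
  Oriented-cong e oriented = trans (sym (embed-cong e i1)) oriented

  Square-injective : ∀ {a b a' b'} → Good a → Good b → Good a' → Good b' →
                     (∀ i j → Square a b i j ≡ Square a' b' i j) → a ≗ᵥ a' × b ≗ᵥ b'
  Square-injective {a} {b} {a'} {b'} a-good b-good a'-good b'-good e =
    embed-injective a-good a'-good (λ i → cancel (NP.+-cancelʳ-≡ 1 _ _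
       (trans (cong (λ z → embed a i + z + 1) (sym (embed-i0 b)))
         (trans (e i i0) (cong (λ z → embed a' i + z + 1) (embed-i0 b')))))) ,
    embed-injective b-good b'-good (λ j → NP.+-cancelʳ-≡ 1 _ _
       (trans (cong (λ z → z + embed b j + 1) (sym (embed-i0 a)))
         (trans (e i0 j) (cong (λ z → z + embed b' j + 1) (embed-i0 a')))))
    where
    cancel : ∀ {x y} → x + 0 ≡ y + 0 → x ≡ y
    cancel {x} {y} h = trans (sym (NP.+-identityʳ x)) (trans h (NP.+-identityʳ y))

  toSquare-cong : ∀ {S T} → S ≈ T → ∀ i j → M (toSquare S) i j ≡ M (toSquare T) i j
  toSquare-cong {S} {T} S≈T = go (≈⇒ S≈T) (embed (second S) i1 ≟ 1)
    where
    go : UPairEq (first S) (second S) (first T) (second T) → Dec (Oriented (second S)) →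
         ∀ i j → M (toSquare S) i j ≡ M (toSquare T) i j
    go (inj₁ (ea , eb)) (yes o) i j = trans (toSquare-oriented S o i j)
      (trans (Square-cong ea eb i j) (sym (toSquare-oriented T (Oriented-cong eb o) i j)))
    go (inj₁ (ea , eb)) (no ¬o) i j = let o = oriented-other S ¬o in trans (toSquare-transposed S o i j)
      (trans (Square-cong eb ea i j) (sym (toSquare-transposed T (Oriented-cong ea o) i j)))
    go (inj₂ (ea , eb)) (yes o) i j = trans (toSquare-oriented S o i j)
      (trans (Square-cong ea eb i j) (sym (toSquare-transposed T (Oriented-cong eb o) i j)))
    go (inj₂ (ea , eb)) (no ¬o) i j = let o = oriented-other S ¬o in trans (toSquare-transposed S o i j)
      (trans (Square-cong eb ea i j) (sym (toSquare-oriented T (Oriented-cong ea o) i j)))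

  toSquare-injective : ∀ {S T} → (∀ i j → M (toSquare S) i j ≡ M (toSquare T) i j) → S ≈ T
  toSquare-injective {S} {T} e = go (embed (second S) i1 ≟ 1) (embed (second T) i1 ≟ 1)
    where
    go : Dec (Oriented (second S)) → Dec (Oriented (second T)) → S ≈ T
    go (yes p) (yes q) = ⇒≈ (inj₁ (Square-injective (first-good S) (second-good S) (first-good T) (second-good T)
      (λ i j → trans (sym (toSquare-oriented S p i j)) (trans (e i j) (toSquare-oriented T q i j)))))
    go (yes p) (no ¬q) = ⇒≈ (inj₂ (Square-injective (first-good S) (second-good S) (second-good T) (first-good T)
      (λ i j → trans (sym (toSquare-oriented S p i j)) (trans (e i j) (toSquare-transposed T (oriented-other T ¬q) i j)))))
    go (no ¬p) (yes q) = ⇒≈ (inj₂ (swap (Square-injective (second-good S) (first-good S) (first-good T) (second-good T)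
      (λ i j → trans (sym (toSquare-transposed S (oriented-other S ¬p) i j)) (trans (e i j) (toSquare-oriented T q i j))))))
    go (no ¬p) (no ¬q) = ⇒≈ (inj₁ (swap (Square-injective (second-good S) (first-good S) (second-good T) (first-good T)
      (λ i j → trans (sym (toSquare-transposed S (oriented-other S ¬p) i j))
                 (trans (e i j) (toSquare-transposed T (oriented-other T ¬q) i j))))))

  bijection : Bijection Sys (PRS n)
  bijection = record
    { to = toSquare
    ; cong = toSquare-cong
    ; bijective = toSquare-injective , surjective
    }
    where
    surjective : ∀ X → ∃ λ S → ∀ {Z} → Z ≈ S → ∀ i j → M (toSquare Z) i j ≡ M X i j
    surjective X with decode X
    ... | S , oriented , e = S , λ Z≈S i j → trans (toSquare-cong Z≈S i j) (trans (toSquare-oriented S oriented i j) (e i j))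

-- An axis of length n = m + g + m: a lower half, read backwards, a middle part of length g, and an upper half.
module Axis (p g n : ℕ) (n≡ : n ≡ suc p + g + suc p) where
  m : ℕ
  m = suc p

  m+g≤n : m + g ≤ n
  m+g≤n = subst (m + g ≤_) (sym n≡) (NP.m≤m+n (m + g) m)

  dn-bound : ∀ (k : Fin m) → p ∸ toℕ k < n
  dn-bound k = NP.≤-<-trans (NP.m∸n≤m p (toℕ k)) (NP.<-≤-trans (NP.n<1+n p) (NP.≤-trans (NP.m≤m+n m g) m+g≤n))

  mid-bound : ∀ (l : Fin g) → m + toℕ l < n
  mid-bound l = NP.<-≤-trans (NP.+-monoʳ-< m (FP.toℕ<n l)) m+g≤n

  up-bound : ∀ (k : Fin m) → m + g + toℕ k < n
  up-bound k = subst (m + g + toℕ k <_) (sym n≡) (NP.+-monoʳ-< (m + g) (FP.toℕ<n k))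

  dn up : Fin m → Fin n
  dn k = fromℕ< (dn-bound k)
  up k = fromℕ< (up-bound k)

  mid : Fin g → Fin n
  mid l = fromℕ< (mid-bound l)

  toℕ-dn : ∀ k → toℕ (dn k) ≡ p ∸ toℕ k
  toℕ-dn k = toℕ-fromℕ< (dn-bound k)

  toℕ-mid : ∀ l → toℕ (mid l) ≡ m + toℕ l
  toℕ-mid l = toℕ-fromℕ< (mid-bound l)

  toℕ-up : ∀ k → toℕ (up k) ≡ m + g + toℕ k
  toℕ-up k = toℕ-fromℕ< (up-bound k)

  data Position : Fin n → Set where
    at-dn  : ∀ k → Position (dn k)
    at-mid : ∀ l → Position (mid l)
    at-up  : ∀ k → Position (up k)

  offset< : ∀ {x} a b → a ≤ x → x < a + b → x ∸ a < b
  offset< {x} a b a≤x x<a+b = NP.+-cancelˡ-< a _ _ (subst (_< a + b) (sym (NP.m+[n∸m]≡n a≤x)) x<a+b)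

  position : ∀ i → Position i
  position i with toℕ i ℕ.<? m
  ... | yes i<m = subst Position (sym i≡dn) (at-dn k)
    where
    k<m : p ∸ toℕ i < m
    k<m = s≤s (NP.m∸n≤m p (toℕ i))
    k = fromℕ< k<m
    i≡dn : i ≡ dn k
    i≡dn = toℕ-injective (trans (sym (NP.m∸[m∸n]≡n (ℕ.s≤s⁻¹ i<m)))
             (trans (cong (p ∸_) (sym (toℕ-fromℕ< k<m))) (sym (toℕ-dn k))))
  ... | no i≮m with toℕ i ℕ.<? m + g
  ...   | yes i<m+g = subst Position (sym i≡mid) (at-mid l)
    where
    m≤i = NP.≮⇒≥ i≮m
    l<g = offset< m g m≤i i<m+g
    l = fromℕ< l<g
    i≡mid : i ≡ mid l
    i≡mid = toℕ-injective (trans (sym (NP.m+[n∸m]≡n m≤i))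
              (trans (cong (m +_) (sym (toℕ-fromℕ< l<g))) (sym (toℕ-mid l))))
  ...   | no i≮m+g = subst Position (sym i≡up) (at-up k)
    where
    m+g≤i = NP.≮⇒≥ i≮m+g
    k<m = offset< (m + g) m m+g≤i (subst (toℕ i <_) n≡ (FP.toℕ<n i))
    k = fromℕ< k<m
    i≡up : i ≡ up k
    i≡up = toℕ-injective (trans (sym (NP.m+[n∸m]≡n m+g≤i))
             (trans (cong (m + g +_) (sym (toℕ-fromℕ< k<m))) (sym (toℕ-up k))))

  dn<mid : ∀ k l → dn k <ᶠ mid l
  dn<mid k l = subst₂ _<_ (sym (toℕ-dn k)) (sym (toℕ-mid l)) (NP.<-≤-trans (s≤s (NP.m∸n≤m p (toℕ k))) (NP.m≤m+n m (toℕ l)))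

  mid<up : ∀ l k → mid l <ᶠ up k
  mid<up l k = subst₂ _<_ (sym (toℕ-mid l)) (sym (toℕ-up k)) (NP.<-≤-trans (NP.+-monoʳ-< m (FP.toℕ<n l)) (NP.m≤m+n (m + g) (toℕ k)))

  dn<up : ∀ k k' → dn k <ᶠ up k'
  dn<up k k' = subst₂ _<_ (sym (toℕ-dn k)) (sym (toℕ-up k'))
                 (NP.<-≤-trans (s≤s (NP.m∸n≤m p (toℕ k))) (NP.≤-trans (NP.m≤m+n m g) (NP.m≤m+n (m + g) (toℕ k'))))

  up-mono : ∀ {k k'} → k <ᶠ k' → up k <ᶠ up k'
  up-mono {k} {k'} lt = subst₂ _<_ (sym (toℕ-up k)) (sym (toℕ-up k')) (NP.+-monoʳ-< (m + g) lt)

  up-reflects : ∀ {k k'} → up k <ᶠ up k' → k <ᶠ k'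
  up-reflects {k} {k'} lt = NP.+-cancelˡ-< (m + g) _ _ (subst₂ _<_ (toℕ-up k) (toℕ-up k') lt)

  dn-antitone : ∀ {k k'} → k <ᶠ k' → dn k' <ᶠ dn k
  dn-antitone {k} {k'} lt = subst₂ _<_ (sym (toℕ-dn k')) (sym (toℕ-dn k)) (NP.∸-monoʳ-< lt (ℕ.s≤s⁻¹ (FP.toℕ<n k')))

  dn-reflects : ∀ {k k'} → dn k <ᶠ dn k' → k' <ᶠ k
  dn-reflects {k} {k'} lt with toℕ k' ℕ.<? toℕ k
  ... | yes k'<k = k'<k
  ... | no k'≮k = ⊥-elim (NP.≤⇒≯ (subst₂ _≤_ (sym (toℕ-dn k')) (sym (toℕ-dn k)) (NP.∸-monoʳ-≤ p (NP.≮⇒≥ k'≮k))) lt)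

  Side : Set
  Side = Fin m ⊎ Fin g ⊎ Fin m

  sideOf : ∀ {i} → Position i → Side
  sideOf (at-dn k) = inj₁ k
  sideOf (at-mid l) = inj₂ (inj₁ l)
  sideOf (at-up k) = inj₂ (inj₂ k)

  along : (Side → ℕ) → Fin n → ℕ
  along f i = f (sideOf (position i))

  dn-injective : ∀ {k k'} → dn k ≡ dn k' → k ≡ k'
  dn-injective {k} {k'} e = toℕ-injective (trans (sym (NP.m∸[m∸n]≡n (ℕ.s≤s⁻¹ (FP.toℕ<n k))))
    (trans (cong (p ∸_) (trans (sym (toℕ-dn k)) (trans (cong toℕ e) (toℕ-dn k'))))
      (NP.m∸[m∸n]≡n (ℕ.s≤s⁻¹ (FP.toℕ<n k')))))

  mid-injective : ∀ {l l'} → mid l ≡ mid l' → l ≡ l'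
  mid-injective {l} {l'} e = toℕ-injective (NP.+-cancelˡ-≡ m _ _ (trans (sym (toℕ-mid l)) (trans (cong toℕ e) (toℕ-mid l'))))

  up-injective : ∀ {k k'} → up k ≡ up k' → k ≡ k'
  up-injective {k} {k'} e = toℕ-injective (NP.+-cancelˡ-≡ (m + g) _ _ (trans (sym (toℕ-up k)) (trans (cong toℕ e) (toℕ-up k'))))

  sideOf-unique : ∀ {i j} (pos : Position i) (pos' : Position j) → i ≡ j → sideOf pos ≡ sideOf pos'
  sideOf-unique (at-dn k)  (at-dn k')  e = cong inj₁ (dn-injective e)
  sideOf-unique (at-dn k)  (at-mid l)  e = ⊥-elim (FP.<⇒≢ (dn<mid k l) e)
  sideOf-unique (at-dn k)  (at-up k')  e = ⊥-elim (FP.<⇒≢ (dn<up k k') e)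
  sideOf-unique (at-mid l) (at-dn k)   e = ⊥-elim (FP.<⇒≢ (dn<mid k l) (sym e))
  sideOf-unique (at-mid l) (at-mid l') e = cong (λ x → inj₂ (inj₁ x)) (mid-injective e)
  sideOf-unique (at-mid l) (at-up k)   e = ⊥-elim (FP.<⇒≢ (mid<up l k) e)
  sideOf-unique (at-up k)  (at-dn k')  e = ⊥-elim (FP.<⇒≢ (dn<up k' k) (sym e))
  sideOf-unique (at-up k)  (at-mid l)  e = ⊥-elim (FP.<⇒≢ (mid<up l k) (sym e))
  sideOf-unique (at-up k)  (at-up k')  e = cong (λ x → inj₂ (inj₂ x)) (up-injective e)

  -- position (dn k) does not reduce to at-dn k, so evaluating along at a known position needs a proof.
  along-position : ∀ f {i} (pos : Position i) → along f i ≡ f (sideOf pos)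
  along-position f {i} pos = cong f (sideOf-unique (position i) pos refl)

  along-cong : ∀ {f f'} → (∀ s → f s ≡ f' s) → ∀ i → along f i ≡ along f' i
  along-cong f≗f' i = f≗f' (sideOf (position i))

  opposite-up : ∀ k → opposite (up k) ≡ dn k
  opposite-up k = toℕ-injective (begin
    toℕ (opposite (up k))                  ≡⟨ FP.opposite-prop (up k) ⟩
    n ∸ suc (toℕ (up k))                   ≡⟨ cong₂ (λ x y → x ∸ suc y) n≡ (toℕ-up k) ⟩
    (m + g + m) ∸ suc (m + g + toℕ k)      ≡⟨ cong ((m + g + m) ∸_) (sym (NP.+-suc (m + g) (toℕ k))) ⟩
    (m + g + m) ∸ (m + g + suc (toℕ k))    ≡⟨ NP.[m+n]∸[m+o]≡n∸o (m + g) m (suc (toℕ k)) ⟩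
    p ∸ toℕ k                              ≡⟨ sym (toℕ-dn k) ⟩
    toℕ (dn k)                             ∎)
    where open ≡-Reasoning

  opposite-dn : ∀ k → opposite (dn k) ≡ up k
  opposite-dn k = trans (cong opposite (sym (opposite-up k))) (FP.opposite-involutive (up k))

  opposite-mid : ∀ l → opposite (mid l) ≡ mid (opposite l)
  opposite-mid l = toℕ-injective (begin
    toℕ (opposite (mid l))                 ≡⟨ FP.opposite-prop (mid l) ⟩
    n ∸ suc (toℕ (mid l))                  ≡⟨ cong₂ (λ x y → x ∸ suc y) n≡ (toℕ-mid l) ⟩
    (m + g + m) ∸ suc (m + toℕ l)          ≡⟨ cong₂ _∸_ (NP.+-assoc m g m) (sym (NP.+-suc m (toℕ l))) ⟩
    (m + (g + m)) ∸ (m + suc (toℕ l))      ≡⟨ NP.[m+n]∸[m+o]≡n∸o m (g + m) (suc (toℕ l)) ⟩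
    (g + m) ∸ suc (toℕ l)                  ≡⟨ NP.+-∸-comm m (FP.toℕ<n l) ⟩
    (g ∸ suc (toℕ l)) + m                  ≡⟨ NP.+-comm _ m ⟩
    m + (g ∸ suc (toℕ l))                  ≡⟨ cong (m +_) (sym (FP.opposite-prop l)) ⟩
    m + toℕ (opposite l)                   ≡⟨ sym (toℕ-mid (opposite l)) ⟩
    toℕ (mid (opposite l))                 ∎)
    where open ≡-Reasoning

  last : Fin m
  last = F.fromℕ p

  i0 : Fin n
  i0 = dn last

  toℕ-i0 : toℕ i0 ≡ 0
  toℕ-i0 = trans (toℕ-dn last) (trans (cong (p ∸_) (FP.toℕ-fromℕ p)) (NP.n∸n≡0 p))

  1<n : 1 < n
  1<n = subst (1 <_) (sym n≡) (NP.≤-trans (NP.+-mono-≤ {1} {m} {1} {m} (s≤s z≤n) (s≤s z≤n)) (NP.+-monoˡ-≤ m (NP.m≤m+n m g)))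

  i1 : Fin n
  i1 = fromℕ< 1<n

  toℕ-i1 : toℕ i1 ≡ 1
  toℕ-i1 = toℕ-fromℕ< 1<n

  2≤n*n : 2 ≤ n * n
  2≤n*n = NP.≤-trans 1<n (NP.m≤m*n n n {{ℕ.>-nonZero (NP.<-trans (s≤s z≤n) 1<n)}})

-- The even case

-- The doubled entries 2x of an even square lie symmetrically around 2H + 1, at odd distances less than 2H.
module Centred (H : ℕ) where
  centre : ℕ
  centre = H + H + 1

  OddBelow : ℕ → Set
  OddBelow v = ∃[ t ] (t < H × v ≡ suc (2 * t))

  InRange : ℕ → Set
  InRange x = 1 ≤ x × x ≤ H + H

  private
    double-above : ∀ H t → (suc H + t) + (suc H + t) ≡ H + H + 1 + suc (2 * t)
    double-above = solve-∀

    double-below : ∀ x t → (x + t) + (x + t) + 1 ≡ x + x + suc (2 * t)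
    double-below = solve-∀

  odd⇒above : ∀ {v} → OddBelow v → ∃[ x ] x + x ≡ centre + v
  odd⇒above (t , _ , refl) = suc H + t , double-above H t

  above⇒inRange⇔odd : ∀ {x v} → x + x ≡ centre + v → InRange x ⇔ OddBelow v
  above⇒inRange⇔odd {x} {v} e = mk⇔ to from
    where
    to : InRange x → OddBelow v
    to (_ , x≤2H) = t , t<H , NP.+-cancelˡ-≡ centre _ _ (trans (sym e)
                      (trans (cong (λ z → z + z) (sym x≡)) (double-above H t)))
      where
      H<x : H < x
      H<x = double-cancel-< H x (subst (H + H <_) (sym e)
              (subst (_≤ centre + v) (NP.+-comm (H + H) 1) (NP.m≤m+n centre v)))
      t = x ∸ suc H
      x≡ : suc H + t ≡ x
      x≡ = NP.m+[n∸m]≡n H<x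
      t<H : t < H
      t<H = NP.+-cancelˡ-< H t H (subst (_≤ H + H) (sym x≡) x≤2H)
    from : OddBelow v → InRange x
    from (t , t<H , refl) = subst InRange (sym x≡) (s≤s z≤n , NP.+-monoʳ-< H t<H)
      where
      x≡ : x ≡ suc H + t
      x≡ = +-double-injective _ _ (trans e (sym (double-above H t)))

  below⇒inRange⇔odd : ∀ {x v} → x + x + v ≡ centre → InRange x ⇔ OddBelow v
  below⇒inRange⇔odd {x} {v} e = mk⇔ to from
    where
    centre≡ : centre ≡ H + suc H
    centre≡ = trans (NP.+-comm (H + H) 1) (sym (NP.+-suc H H))
    to : InRange x → OddBelow v
    to (1≤x , _) = t , NP.∸-monoʳ-< {H} {x} {0} 1≤x x≤H , NP.+-cancelˡ-≡ (x + x) _ _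
                     (trans e (trans (cong (λ z → z + z + 1) (sym x+t≡H)) (double-below x t)))
      where
      x≤H : x ≤ H
      x≤H = ℕ.s≤s⁻¹ (double-cancel-< x (suc H) (s≤s (subst (x + x ≤_) (trans e centre≡) (NP.m≤m+n (x + x) v))))
      t = H ∸ x
      x+t≡H : x + t ≡ H
      x+t≡H = NP.m+[n∸m]≡n x≤H
    from : OddBelow v → InRange x
    from (t , t<H , refl) = positive x x+x+2t≡2H , subst (x ≤_) x+x+2t≡2H (NP.≤-trans (NP.m≤m+n x x) (NP.m≤m+n (x + x) (2 * t)))
      where
      x+x+2t≡2H : x + x + 2 * t ≡ H + H
      x+x+2t≡2H = NP.suc-injective (trans (sym (NP.+-suc (x + x) (2 * t))) (trans e (trans centre≡ (NP.+-suc H H))))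
      positive : ∀ x → x + x + 2 * t ≡ H + H → 1 ≤ x
      positive zero 2t≡2H = ⊥-elim (NP.<-irrefl (+-double-injective t H (trans (sym (2*≡double t)) 2t≡2H)) t<H)
      positive (suc _) _ = s≤s z≤n

  inRange⇒centred : ∀ {x} → InRange x → ∃[ v ] (x + x ≡ centre + v ⊎ x + x + v ≡ centre)
  inRange⇒centred {x} _ with H ℕ.<? x
  ... | yes H<x = suc (2 * t) , inj₁ (trans (cong (λ z → z + z) (sym (NP.m+[n∸m]≡n H<x))) (double-above H t))
    where t = x ∸ suc H
  ... | no H≮x = suc (2 * t) , inj₂ (trans (sym (double-below x t)) (cong (λ z → z + z + 1) (NP.m+[n∸m]≡n (NP.≮⇒≥ H≮x))))
    where t = H ∸ x

  above-below-disjoint : ∀ {x v o} → x + x ≡ centre + v → x + x + o ≡ centre → OddBelow v → ⊥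
  above-below-disjoint {o = o} above below (t , _ , refl)
    with NP.+-cancelˡ-≡ centre (suc (2 * t) + o) 0 (trans (sym (NP.+-assoc centre (suc (2 * t)) o))
           (trans (cong (_+ o) (sym above)) (trans below (sym (NP.+-identityʳ centre)))))
  ... | ()


module EvenEmbedding (p : ℕ) where
  n : ℕ
  n = 2 * suc p

  n≡m+0+m : n ≡ suc p + 0 + suc p
  n≡m+0+m = rearrange p
    where rearrange : ∀ p → 2 * suc p ≡ suc p + 0 + suc p
          rearrange = solve-∀

  open Axis p 0 n n≡m+0+m public

  largest : (Fin m → ℕ) → ℕ
  largest a = a last

  halfUp : (Fin m → ℕ) → Fin m → ℕ
  halfUp a k = ⌊ largest a + a k /2⌋

  embedSide : (Fin m → ℕ) → Side → ℕ
  embedSide a (inj₁ k) = largest a ∸ halfUp a k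
  embedSide a (inj₂ (inj₂ k)) = halfUp a k

  embed : (Fin m → ℕ) → Fin n → ℕ
  embed a = along (embedSide a)

  embed-dn : ∀ a k → embed a (dn k) ≡ largest a ∸ halfUp a k
  embed-dn a k = along-position (embedSide a) (at-dn k)

  embed-up : ∀ a k → embed a (up k) ≡ halfUp a k
  embed-up a k = along-position (embedSide a) (at-up k)

  halfUp-last : ∀ a → halfUp a last ≡ largest a
  halfUp-last a = sym (NP.n≡⌊n+n/2⌋ (largest a))

  embed-i0 : ∀ a → embed a i0 ≡ 0
  embed-i0 a = trans (embed-dn a last) (trans (cong (largest a ∸_) (halfUp-last a)) (NP.n∸n≡0 (largest a)))

  embed-cong : ∀ {a a'} → a ≗ᵥ a' → ∀ i → embed a i ≡ embed a' i
  embed-cong {a} {a'} e = along-cong side-cong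
    where
    halfUp-cong : ∀ k → halfUp a k ≡ halfUp a' k
    halfUp-cong k = cong ⌊_/2⌋ (cong₂ _+_ (e last) (e k))
    side-cong : ∀ s → embedSide a s ≡ embedSide a' s
    side-cong (inj₁ k) = cong₂ _∸_ (e last) (halfUp-cong k)
    side-cong (inj₂ (inj₂ k)) = halfUp-cong k

  Good : (Fin m → ℕ) → Set
  Good a = StrictIncPos m a × (∀ k → IsEven (largest a + a k))

  module _ {a : Fin m → ℕ} (a-good : Good a) where
    a-positive : ∀ k → 1 ≤ a k
    a-positive = proj₁ (proj₁ a-good)

    a-increasing : Increasing a
    a-increasing = proj₂ (proj₁ a-good)

    halfUp-double : ∀ k → halfUp a k + halfUp a k ≡ largest a + a k
    halfUp-double k with proj₂ a-good k
    ... | h , e = trans (cong₂ _+_ halfUp≡h halfUp≡h) (sym e)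
      where halfUp≡h : halfUp a k ≡ h
            halfUp≡h = trans (cong ⌊_/2⌋ e) (sym (NP.n≡⌊n+n/2⌋ h))

    halfUp-increasing : Increasing (halfUp a)
    halfUp-increasing k k' lt = double-cancel-< _ _
      (subst₂ _<_ (sym (halfUp-double k)) (sym (halfUp-double k')) (NP.+-monoʳ-< (largest a) (a-increasing k k' lt)))

    halfUp≤largest : ∀ k → halfUp a k ≤ largest a
    halfUp≤largest k = double-cancel-≤ _ _ (subst (_≤ largest a + largest a) (sym (halfUp-double k))
                         (NP.+-monoʳ-≤ (largest a) (increasing⇒≤last a a-increasing k)))

    embed-up-double : ∀ k → embed a (up k) + embed a (up k) ≡ largest a + a k
    embed-up-double k = trans (cong (λ x → x + x) (embed-up a k)) (halfUp-double k)

    embed-dn+up : ∀ k → embed a (dn k) + embed a (up k) ≡ largest a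
    embed-dn+up k = trans (cong₂ _+_ (embed-dn a k) (embed-up a k)) (NP.m∸n+n≡m (halfUp≤largest k))

    embed-dn-double : ∀ k → embed a (dn k) + embed a (dn k) + a k ≡ largest a
    embed-dn-double k = NP.+-cancelʳ-≡ (largest a) _ _ (begin
      d + d + a k + largest a             ≡⟨ regroup d (a k) (largest a) ⟩
      d + d + (largest a + a k)           ≡⟨ cong (d + d +_) (sym (embed-up-double k)) ⟩
      d + d + (u + u)                     ≡⟨ regroup′ d u ⟩
      (d + u) + (d + u)                   ≡⟨ cong (λ x → x + x) (embed-dn+up k) ⟩
      largest a + largest a               ∎)
      where
      open ≡-Reasoning
      d = embed a (dn k)
      u = embed a (up k)
      regroup : ∀ d a A → d + d + a + A ≡ d + d + (A + a)
      regroup = solve-∀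
      regroup′ : ∀ d u → d + d + (u + u) ≡ (d + u) + (d + u)
      regroup′ = solve-∀

    embed-opposite-sum : ∀ i → embed a i + embed a (opposite i) ≡ largest a
    embed-opposite-sum i = go (position i)
      where
      go : ∀ {i} → Position i → embed a i + embed a (opposite i) ≡ largest a
      go (at-dn k) = trans (cong (λ j → embed a (dn k) + embed a j) (opposite-dn k)) (embed-dn+up k)
      go (at-up k) = trans (cong (λ j → embed a (up k) + embed a j) (opposite-up k))
                       (trans (NP.+-comm (embed a (up k)) _) (embed-dn+up k))

    embed-sums : ConstantOppositeSums (embed a)
    embed-sums i k = trans (embed-opposite-sum i) (sym (embed-opposite-sum k))

    dn-dn< : ∀ k k' → dn k <ᶠ dn k' → embed a (dn k) < embed a (dn k')
    dn-dn< k k' lt = subst₂ _<_ (sym (embed-dn a k)) (sym (embed-dn a k'))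
        (NP.∸-monoʳ-< (halfUp-increasing k' k (dn-reflects lt)) (halfUp≤largest k))
    dn-up< : ∀ k k' → embed a (dn k) < embed a (up k')
    dn-up< k k' = double-cancel-< (embed a (dn k)) (embed a (up k'))
        (NP.≤-<-trans (NP.≤-trans (NP.m≤m+n (embed a (dn k) + embed a (dn k)) (a k)) (NP.≤-reflexive (embed-dn-double k)))
          (subst (largest a <_) (sym (embed-up-double k')) (NP.m<m+n (largest a) (a-positive k'))))
    up-up< : ∀ k k' → up k <ᶠ up k' → embed a (up k) < embed a (up k')
    up-up< k k' lt = subst₂ _<_ (sym (embed-up a k)) (sym (embed-up a k'))
        (halfUp-increasing k k' (up-reflects lt))

    embed-increasing : Increasing (embed a)
    embed-increasing i i' = go (position i) (position i')
      where
      go : ∀ {i i'} → Position i → Position i' → i <ᶠ i' → embed a i < embed a i'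
      go (at-dn k) (at-dn k') lt = dn-dn< k k' lt
      go (at-dn k) (at-up k') lt = dn-up< k k'
      go (at-up k) (at-dn k') lt = ⊥-elim (NP.<-asym lt (dn<up k' k))
      go (at-up k) (at-up k') lt = up-up< k k' lt

  embed-injective : ∀ {a a'} → Good a → Good a' → (∀ i → embed a i ≡ embed a' i) → a ≗ᵥ a'
  embed-injective {a} {a'} a-good a'-good e k = NP.+-cancelˡ-≡ (largest a) _ _
      (trans (sym (halfUp-double a-good k))
        (trans (cong (λ x → x + x) same-halfUp) (trans (halfUp-double a'-good k) (cong (_+ a' k) (sym same-largest)))))
    where
    same-halfUp : halfUp a k ≡ halfUp a' k
    same-halfUp = trans (sym (embed-up a k)) (trans (e (up k)) (embed-up a' k))
    same-largest : largest a ≡ largest a'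
    same-largest = trans (sym (halfUp-last a)) (trans (sym (embed-up a last))
                     (trans (e (up last)) (trans (embed-up a' last) (halfUp-last a'))))

module EvenEntries (p H : ℕ) where
  open EvenEmbedding p
  open Centred H

  module _ {a b : Fin m → ℕ} (a-good : Good a) (b-good : Good b)
           (largest-sum : largest a + largest b + 1 ≡ H + H) where
    -- Opaque only for type-checking speed.
    opaque
      Sq : Matrix n
      Sq = OuterSum (embed a) (embed b)

      Sq≡OuterSum : ∀ i j → Sq i j ≡ OuterSum (embed a) (embed b) i j
      Sq≡OuterSum i j = refl

    double-Sq : ∀ i j → Sq i j + Sq i j ≡ (embed a i + embed a i) + (embed b j + embed b j) + 2
    double-Sq i j = trans (cong (λ x → x + x) (Sq≡OuterSum i j)) (rearrange (embed a i) (embed b j))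
      where rearrange : ∀ x y → (x + y + 1) + (x + y + 1) ≡ (x + x) + (y + y) + 2
            rearrange = solve-∀

    -- In each quadrant 2 Sq i j is read off from 2 r_i = A ± a_k and 2 c_j = B ± b_l.
    up-up : ∀ k l → Sq (up k) (up l) + Sq (up k) (up l) ≡ centre + (a k + b l)
    up-up k l = trans (double-Sq (up k) (up l))
      (trans (cong₂ (λ x y → x + y + 2) (embed-up-double a-good k) (embed-up-double b-good l))
      (trans (rearrange (largest a) (a k) (largest b) (b l)) (cong (λ z → z + 1 + (a k + b l)) largest-sum)))
      where rearrange : ∀ A a B b → A + a + (B + b) + 2 ≡ A + B + 1 + 1 + (a + b)
            rearrange = solve-∀

    up-dn : ∀ k l → Sq (up k) (dn l) + Sq (up k) (dn l) + b l ≡ centre + a k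
    up-dn k l = trans (cong (_+ b l) (double-Sq (up k) (dn l)))
      (trans (rearrange (embed a (up k) + embed a (up k)) (embed b (dn l) + embed b (dn l)) (b l))
      (trans (cong₂ (λ x y → x + y + 2) (embed-up-double a-good k) (embed-dn-double b-good l))
      (trans (rearrange′ (largest a) (a k) (largest b)) (cong (λ z → z + 1 + a k) largest-sum))))
      where rearrange : ∀ x y b → x + y + 2 + b ≡ x + (y + b) + 2
            rearrange = solve-∀
            rearrange′ : ∀ A a B → A + a + B + 2 ≡ A + B + 1 + 1 + a
            rearrange′ = solve-∀

    dn-up : ∀ k l → Sq (dn k) (up l) + Sq (dn k) (up l) + a k ≡ centre + b l
    dn-up k l = trans (cong (_+ a k) (double-Sq (dn k) (up l)))
      (trans (rearrange (embed a (dn k) + embed a (dn k)) (embed b (up l) + embed b (up l)) (a k))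
      (trans (cong₂ (λ x y → x + y + 2) (embed-dn-double a-good k) (embed-up-double b-good l))
      (trans (rearrange′ (largest a) (b l) (largest b)) (cong (λ z → z + 1 + b l) largest-sum))))
      where rearrange : ∀ x y a → x + y + 2 + a ≡ (x + a) + y + 2
            rearrange = solve-∀
            rearrange′ : ∀ A b B → A + (B + b) + 2 ≡ A + B + 1 + 1 + b
            rearrange′ = solve-∀

    dn-dn : ∀ k l → Sq (dn k) (dn l) + Sq (dn k) (dn l) + (a k + b l) ≡ centre
    dn-dn k l = trans (cong (_+ (a k + b l)) (double-Sq (dn k) (dn l)))
      (trans (rearrange (embed a (dn k) + embed a (dn k)) (embed b (dn l) + embed b (dn l)) (a k) (b l))
      (trans (cong₂ (λ x y → x + y + 2) (embed-dn-double a-good k) (embed-dn-double b-good l))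
      (trans (rearrange′ (largest a) (largest b)) (cong (λ z → z + 1) largest-sum))))
      where rearrange : ∀ x y a b → x + y + 2 + (a + b) ≡ (x + a) + (y + b) + 2
            rearrange = solve-∀
            rearrange′ : ∀ A B → A + B + 2 ≡ A + B + 1 + 1
            rearrange′ = solve-∀

    quadrant : ∀ i j → ∃[ o ] (SumDist a b o × (Sq i j + Sq i j ≡ centre + o ⊎ Sq i j + Sq i j + o ≡ centre))
    quadrant i j = go (position i) (position j)
      where
      go : ∀ {i j} → Position i → Position j →
           ∃[ o ] (SumDist a b o × (Sq i j + Sq i j ≡ centre + o ⊎ Sq i j + Sq i j + o ≡ centre))
      go (at-up k) (at-up l) = _ , (k , l , inj₁ refl) , inj₁ (up-up k l)
      go (at-up k) (at-dn l) = _ , (k , l , inj₂ refl) , ∣-∣-shift centre _ (a k) (b l) (up-dn k l)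
      go (at-dn k) (at-up l) = _ , (k , l , inj₂ refl) ,
        subst (λ z → Sq (dn k) (up l) + Sq (dn k) (up l) ≡ centre + z ⊎ Sq (dn k) (up l) + Sq (dn k) (up l) + z ≡ centre)
              (NP.∣-∣-comm (b l) (a k)) (∣-∣-shift centre _ (b l) (a k) (dn-up k l))
      go (at-dn k) (at-dn l) = _ , (k , l , inj₁ refl) , inj₂ (dn-dn k l)

    value-above : ∀ o → SumDist a b o → ∃[ i ] ∃[ j ] Sq i j + Sq i j ≡ centre + o
    value-above o (k , l , inj₁ refl) = up k , up l , up-up k l
    value-above o (k , l , inj₂ e) with ∣-∣≡⇒cases (a k) (b l) o (sym e)
    ... | inj₁ h = up k , dn l , above-shift centre _ (a k) (b l) o (up-dn k l) h
    ... | inj₂ h = dn k , up l , above-shift centre _ (b l) (a k) o (dn-up k l) h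

    value-below : ∀ o → SumDist a b o → ∃[ i ] ∃[ j ] Sq i j + Sq i j + o ≡ centre
    value-below o (k , l , inj₁ refl) = dn k , dn l , dn-dn k l
    value-below o (k , l , inj₂ e) with ∣-∣≡⇒cases (a k) (b l) o (sym e)
    ... | inj₁ h = dn k , up l , below-shift centre _ (a k) (b l) o (dn-up k l) h
    ... | inj₂ h = up k , dn l , below-shift centre _ (b l) (a k) o (up-dn k l) h

    entries⇒sumDist : HasEntries Sq InRange → ∀ v → SumDist a b v ⇔ OddBelow v
    entries⇒sumDist E v = mk⇔ to from
      where
      to : SumDist a b v → OddBelow v
      to sd with value-above v sd
      ... | i , j , e = Equivalence.to (above⇒inRange⇔odd {Sq i j} {v} e) (Equivalence.to (E _) (i , j , refl))
      from : OddBelow v → SumDist a b v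
      from odd with odd⇒above odd
      ... | x , x-above with Equivalence.from (E x) (Equivalence.from (above⇒inRange⇔odd {x} {v} x-above) odd)
      ... | i , j , refl with quadrant i j
      ... | o , sd , inj₁ o-above = subst (SumDist a b) (NP.+-cancelˡ-≡ centre _ _ (trans (sym o-above) x-above)) sd
      ... | o , sd , inj₂ o-below = ⊥-elim (above-below-disjoint {Sq i j} {v} {o} x-above o-below odd)

    sumDist⇒entries : (∀ v → SumDist a b v ⇔ OddBelow v) → HasEntries Sq InRange
    sumDist⇒entries S v = mk⇔ to from
      where
      to : (∃[ i ] ∃[ j ] v ≡ Sq i j) → InRange v
      to (i , j , refl) with quadrant i j
      ... | o , sd , inj₁ above = Equivalence.from (above⇒inRange⇔odd {Sq i j} {o} above) (Equivalence.to (S o) sd)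
      ... | o , sd , inj₂ below = Equivalence.from (below⇒inRange⇔odd {Sq i j} {o} below) (Equivalence.to (S o) sd)
      from : InRange v → ∃[ i ] ∃[ j ] v ≡ Sq i j
      from v-range with inRange⇒centred v-range
      ... | w , inj₁ above with value-above w (Equivalence.from (S w) (Equivalence.to (above⇒inRange⇔odd {v} {w} above) v-range))
      ...   | i , j , e = i , j , +-double-injective _ _ (trans above (sym e))
      from v-range | w , inj₂ below with value-below w (Equivalence.from (S w) (Equivalence.to (below⇒inRange⇔odd {v} {w} below) v-range))
      ...   | i , j , e = i , j , +-double-injective _ _ (NP.+-cancelʳ-≡ w _ _ (trans below (sym e)))

module EvenCase (p : ℕ) where
  open EvenEmbedding p

  H : ℕ
  H = 2 * (m * m)

  open EvenEntries p H
  open Centred H using (InRange)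

  n*n≡H+H : n * n ≡ H + H
  n*n≡H+H = rearrange p
    where rearrange : ∀ p → (2 * suc p) * (2 * suc p) ≡ 2 * (suc p * suc p) + 2 * (suc p * suc p)
          rearrange = solve-∀

  inRange⇒square : ∀ {M : Matrix n} → HasEntries M InRange → HasEntries M (λ v → 1 ≤ v × v ≤ n * n)
  inRange⇒square {M} = subst (λ N → HasEntries M (λ v → 1 ≤ v × v ≤ N)) (sym n*n≡H+H)

  open NonInclSADSys

  sum-odd : ∀ (S : NonInclSADSys m) j k → IsOdd (a S j + b S k)
  sum-odd S j k with Equivalence.to (sad S _) (j , k , inj₁ refl)
  ... | t , _ , e = subst IsOdd (sym e) (odd-1+2* t)

  -- All a_j + b_k are odd, so all a_j have the parity of a_m.
  first-good : ∀ S → Good (a S)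
  first-good S = a-inc S , λ k → odd-sums⇒even (largest (a S)) (a S k) (b S F.zero)
    (subst IsOdd (NP.+-comm (a S last) (b S F.zero)) (sum-odd S last F.zero))
    (subst IsOdd (NP.+-comm (a S k) (b S F.zero)) (sum-odd S k F.zero))

  second-good : ∀ S → Good (b S)
  second-good S = b-inc S , λ k → odd-sums⇒even (largest (b S)) (b S k) (a S F.zero)
    (sum-odd S F.zero last) (sum-odd S F.zero k)

  -- a_m + b_m is the largest value 4m² − 1 of the target.
  largest-sum : ∀ S → largest (a S) + largest (b S) + 1 ≡ H + H
  largest-sum S = NP.≤-antisym upper lower
    where
    suc-double : ∀ t → suc (2 * t) + 1 ≡ suc t + suc t
    suc-double = solve-∀
    upper : largest (a S) + largest (b S) + 1 ≤ H + H
    upper with Equivalence.to (sad S _) (last , last , inj₁ refl)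
    ... | t , t<H , e = subst (_≤ H + H) (sym (trans (cong (_+ 1) e) (suc-double t))) (NP.+-mono-≤ t<H t<H)
    lower : H + H ≤ largest (a S) + largest (b S) + 1
    lower = subst (_≤ largest (a S) + largest (b S) + 1) (suc-double (ℕ.pred H))
              (NP.+-monoˡ-≤ 1 (sumDist≤largest (proj₂ (a-inc S)) (proj₂ (b-inc S))
                (Equivalence.from (sad S _) (ℕ.pred H , NP.n<1+n _ , refl))))

  system-entries : ∀ S → HasEntries (OuterSum (embed (a S)) (embed (b S))) (λ v → 1 ≤ v × v ≤ n * n)
  system-entries S = inRange⇒square (hasEntries-cong (Sq≡OuterSum (first-good S) (second-good S) (largest-sum S))
                       (sumDist⇒entries (first-good S) (second-good S) (largest-sum S) (sad S)))

  module FromRowSequence (f : Fin n → ℕ) (f-increasing : Increasing f) (f-i0 : f i0 ≡ 0)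
                         (f-opposite-sum : ∀ i → f i + f (opposite i) ≡ f (opposite i0)) where
    fL : ℕ
    fL = f (opposite i0)

    f-dn<f-up : ∀ k → f (dn k) < f (up k)
    f-dn<f-up k = f-increasing (dn k) (up k) (dn<up k k)

    a′ : Fin m → ℕ
    a′ k = f (up k) ∸ f (dn k)

    a′+dn : ∀ k → a′ k + f (dn k) ≡ f (up k)
    a′+dn k = NP.m∸n+n≡m (NP.<⇒≤ (f-dn<f-up k))

    up+dn : ∀ k → f (up k) + f (dn k) ≡ fL
    up+dn k = subst (λ j → f (up k) + f j ≡ fL) (opposite-up k) (f-opposite-sum (up k))

    largest-a′ : largest a′ ≡ fL
    largest-a′ = trans (cong (f (up last) ∸_) f-i0)
                   (trans (sym (NP.+-identityʳ _)) (trans (cong (f (up last) +_) (sym f-i0)) (up+dn last)))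

    largest+a′ : ∀ k → largest a′ + a′ k ≡ f (up k) + f (up k)
    largest+a′ k = trans (cong (_+ a′ k) (trans largest-a′ (sym (up+dn k))))
                     (trans (rearrange (f (up k)) (f (dn k)) (a′ k)) (cong (f (up k) +_) (a′+dn k)))
      where rearrange : ∀ x y z → x + y + z ≡ x + (z + y)
            rearrange = solve-∀

    a′-good : Good a′
    a′-good = ((λ k → NP.m<n⇒0<n∸m (f-dn<f-up k)) , increasing) , (λ k → f (up k) , largest+a′ k)
      where
      increasing : Increasing a′
      increasing k k' lt = ∸-mono-< (f-increasing (up k) (up k') (up-mono lt))
                                    (f-increasing (dn k') (dn k) (dn-antitone lt)) (NP.<⇒≤ (f-dn<f-up k))

    halfUp-a′ : ∀ k → halfUp a′ k ≡ f (up k)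
    halfUp-a′ k = trans (cong ⌊_/2⌋ (largest+a′ k)) (sym (NP.n≡⌊n+n/2⌋ (f (up k))))

    embed-a′ : ∀ i → embed a′ i ≡ f i
    embed-a′ i = go (position i)
      where
      go : ∀ {i} → Position i → embed a′ i ≡ f i
      go (at-dn k) = trans (embed-dn a′ k) (trans (cong₂ _∸_ (trans largest-a′ (sym (up+dn k))) (halfUp-a′ k))
                       (NP.m+n∸m≡n (f (up k)) (f (dn k))))
      go (at-up k) = trans (embed-up a′ k) (halfUp-a′ k)

  decode : ∀ (X : PrincipalRevSquare n) → Σ (NonInclSADSys m) λ S →
           embed (b S) i1 ≡ 1 × (∀ i j → OuterSum (embed (a S)) (embed (b S)) i j ≡ PrincipalRevSquare.M X i j)
  decode X = S , trans (C.embed-a′ i1) (cong (_∸ 1) (m12 i0 i1 toℕ-i0 toℕ-i1)) , X≡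
    where
    open Offsets X i0 toℕ-i0
    open PrincipalRevSquare X using (entries; m12)
    module R = FromRowSequence r r-increasing r-i0 r-opposite-sum
    module C = FromRowSequence c c-increasing c-i0 c-opposite-sum
    X≡ : ∀ i j → OuterSum (embed R.a′) (embed C.a′) i j ≡ PrincipalRevSquare.M X i j
    X≡ i j = trans (cong₂ (λ x y → x + y + 1) (R.embed-a′ i) (C.embed-a′ j)) (sym (M≡OuterSum i j))
    sum : largest R.a′ + largest C.a′ + 1 ≡ H + H
    sum = trans (cong₂ (λ x y → x + y + 1) R.largest-a′ C.largest-a′) (trans r+c-last n*n≡H+H)
    inRange : HasEntries (Sq R.a′-good C.a′-good sum) InRange
    inRange = hasEntries-cong (λ i j → trans (sym (X≡ i j)) (sym (Sq≡OuterSum R.a′-good C.a′-good sum i j)))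
                (subst (λ N → HasEntries (PrincipalRevSquare.M X) (λ v → 1 ≤ v × v ≤ N)) n*n≡H+H entries)
    S : NonInclSADSys m
    S = record { a = R.a′ ; b = C.a′ ; a-inc = proj₁ R.a′-good ; b-inc = proj₁ C.a′-good
               ; sad = entries⇒sumDist R.a′-good C.a′-good sum inRange }

  bijection : Bijection (NonInclSAD m) (PRS n)
  bijection = OuterSumBijection.bijection n m i0 i1 toℕ-i0 toℕ-i1 2≤n*n (NonInclSAD m) a b (λ e → e) (λ e → e)
                embed embed-cong embed-i0 Good first-good second-good embed-injective embed-increasing embed-sums
                system-entries decode

-- The odd case

module OddEmbedding (p : ℕ) where
  n : ℕ
  n = suc (2 * suc p)

  n≡m+1+m : n ≡ suc p + 1 + suc p
  n≡m+1+m = rearrange p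
    where rearrange : ∀ p → suc (2 * suc p) ≡ suc p + 1 + suc p
          rearrange = solve-∀

  open Axis p 1 n n≡m+1+m public

  largest : (Fin m → ℕ) → ℕ
  largest a = a last

  embedSide : (Fin m → ℕ) → Side → ℕ
  embedSide a (inj₁ k) = largest a ∸ a k
  embedSide a (inj₂ (inj₁ _)) = largest a
  embedSide a (inj₂ (inj₂ k)) = largest a + a k

  embed : (Fin m → ℕ) → Fin n → ℕ
  embed a = along (embedSide a)

  middle : Fin n
  middle = mid F.zero

  embed-dn : ∀ a k → embed a (dn k) ≡ largest a ∸ a k
  embed-dn a k = along-position (embedSide a) (at-dn k)

  embed-mid : ∀ a l → embed a (mid l) ≡ largest a
  embed-mid a l = along-position (embedSide a) (at-mid l)

  embed-up : ∀ a k → embed a (up k) ≡ largest a + a k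
  embed-up a k = along-position (embedSide a) (at-up k)

  embed-i0 : ∀ a → embed a i0 ≡ 0
  embed-i0 a = trans (embed-dn a last) (NP.n∸n≡0 (largest a))

  embed-cong : ∀ {a a'} → a ≗ᵥ a' → ∀ i → embed a i ≡ embed a' i
  embed-cong {a} {a'} e = along-cong side-cong
    where
    side-cong : ∀ s → embedSide a s ≡ embedSide a' s
    side-cong (inj₁ k) = cong₂ _∸_ (e last) (e k)
    side-cong (inj₂ (inj₁ _)) = e last
    side-cong (inj₂ (inj₂ k)) = cong₂ _+_ (e last) (e k)

  Good : (Fin m → ℕ) → Set
  Good = StrictIncPos m

  module _ {a : Fin m → ℕ} (a-good : Good a) where
    a-positive : ∀ k → 1 ≤ a k
    a-positive = proj₁ a-good

    a-increasing : Increasing a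
    a-increasing = proj₂ a-good

    embed-dn+a : ∀ k → embed a (dn k) + a k ≡ largest a
    embed-dn+a k = trans (cong (_+ a k) (embed-dn a k)) (NP.m∸n+n≡m (increasing⇒≤last a a-increasing k))

    embed-dn+up : ∀ k → embed a (dn k) + embed a (up k) ≡ largest a + largest a
    embed-dn+up k = trans (cong (embed a (dn k) +_) (embed-up a k))
                      (trans (rearrange (embed a (dn k)) (largest a) (a k)) (cong (largest a +_) (embed-dn+a k)))
      where rearrange : ∀ d A a → d + (A + a) ≡ A + (d + a)
            rearrange = solve-∀

    embed-opposite-sum : ∀ i → embed a i + embed a (opposite i) ≡ largest a + largest a
    embed-opposite-sum i = go (position i)
      where
      go : ∀ {i} → Position i → embed a i + embed a (opposite i) ≡ largest a + largest a
      go (at-dn k) = trans (cong (λ j → embed a (dn k) + embed a j) (opposite-dn k)) (embed-dn+up k)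
      go (at-mid l) = trans (cong (λ j → embed a (mid l) + embed a j) (opposite-mid l))
                        (cong₂ _+_ (embed-mid a l) (embed-mid a (opposite l)))
      go (at-up k) = trans (cong (λ j → embed a (up k) + embed a j) (opposite-up k))
                       (trans (NP.+-comm (embed a (up k)) _) (embed-dn+up k))

    embed-sums : ConstantOppositeSums (embed a)
    embed-sums i k = trans (embed-opposite-sum i) (sym (embed-opposite-sum k))

    dn≤largest : ∀ k → embed a (dn k) ≤ largest a
    dn≤largest k = subst (_≤ largest a) (sym (embed-dn a k)) (NP.m∸n≤m (largest a) (a k))

    largest<up : ∀ k → largest a < embed a (up k)
    largest<up k = subst (largest a <_) (sym (embed-up a k)) (NP.m<m+n (largest a) (a-positive k))

    dn<largest : ∀ k → embed a (dn k) < largest a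
    dn<largest k = subst (_< largest a) (sym (embed-dn a k))
                     (NP.∸-monoʳ-< {largest a} {a k} {0} (a-positive k) (increasing⇒≤last a a-increasing k))

    embed-increasing : Increasing (embed a)
    embed-increasing i i' = go (position i) (position i')
      where
      go : ∀ {i i'} → Position i → Position i' → i <ᶠ i' → embed a i < embed a i'
      go (at-dn k) (at-dn k') lt = subst₂ _<_ (sym (embed-dn a k)) (sym (embed-dn a k'))
        (NP.∸-monoʳ-< (a-increasing k' k (dn-reflects lt)) (increasing⇒≤last a a-increasing k))
      go (at-dn k) (at-mid l) lt = subst (embed a (dn k) <_) (sym (embed-mid a l)) (dn<largest k)
      go (at-dn k) (at-up k') lt = NP.≤-<-trans (dn≤largest k) (largest<up k')
      go (at-mid l) (at-dn k) lt = ⊥-elim (NP.<-asym lt (dn<mid k l))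
      go (at-mid F.zero) (at-mid F.zero) lt = ⊥-elim (NP.<-irrefl refl lt)
      go (at-mid l) (at-up k) lt = subst (_< embed a (up k)) (sym (embed-mid a l)) (largest<up k)
      go (at-up k) (at-dn k') lt = ⊥-elim (NP.<-asym lt (dn<up k' k))
      go (at-up k) (at-mid l) lt = ⊥-elim (NP.<-asym lt (mid<up l k))
      go (at-up k) (at-up k') lt = subst₂ _<_ (sym (embed-up a k)) (sym (embed-up a k'))
        (NP.+-monoʳ-< (largest a) (a-increasing k k' (up-reflects lt)))

  embed-injective : ∀ {a a'} → Good a → Good a' → (∀ i → embed a i ≡ embed a' i) → a ≗ᵥ a'
  embed-injective {a} {a'} _ _ e k = NP.+-cancelˡ-≡ (largest a) _ _
      (trans (sym (embed-up a k)) (trans (e (up k)) (trans (embed-up a' k) (cong (_+ a' k) (sym same-largest)))))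
    where
    same-largest : largest a ≡ largest a'
    same-largest = trans (sym (embed-mid a F.zero)) (trans (e middle) (embed-mid a' F.zero))

module OddEntries (p T : ℕ) where
  open OddEmbedding p

  centre : ℕ
  centre = suc T

  InRange : ℕ → Set
  InRange v = 1 ≤ v × v ≤ suc (T + T)

  Target : ℕ → Set
  Target v = 1 ≤ v × v ≤ T

  private
    up-up′ : ∀ x y a b {R C K} → x ≡ R + a → y ≡ C + b → R + C + 1 ≡ K → x + y + 1 ≡ K + (a + b)
    up-up′ _ _ a b {R} {C} refl refl refl = rearrange R a C b
      where rearrange : ∀ R a C b → R + a + (C + b) + 1 ≡ R + C + 1 + (a + b)
            rearrange = solve-∀
    up-mid′ : ∀ x y a {R C K} → x ≡ R + a → y ≡ C → R + C + 1 ≡ K → x + y + 1 ≡ K + a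
    up-mid′ _ _ a {R} {C} refl refl refl = rearrange R a C
      where rearrange : ∀ R a C → R + a + C + 1 ≡ R + C + 1 + a
            rearrange = solve-∀
    up-dn′ : ∀ x y a b {R C K} → x ≡ R + a → y + b ≡ C → R + C + 1 ≡ K → x + y + 1 + b ≡ K + a
    up-dn′ _ y a b {R} refl refl refl = rearrange R a y b
      where rearrange : ∀ R a y b → R + a + y + 1 + b ≡ R + (y + b) + 1 + a
            rearrange = solve-∀
    mid-up′ : ∀ x y b {R C K} → x ≡ R → y ≡ C + b → R + C + 1 ≡ K → x + y + 1 ≡ K + b
    mid-up′ _ _ b {R} {C} refl refl refl = rearrange R C b
      where rearrange : ∀ R C b → R + (C + b) + 1 ≡ R + C + 1 + b
            rearrange = solve-∀
    mid-dn′ : ∀ x y b {R C K} → x ≡ R → y + b ≡ C → R + C + 1 ≡ K → x + y + 1 + b ≡ K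
    mid-dn′ _ y b {R} refl refl refl = rearrange R y b
      where rearrange : ∀ R y b → R + y + 1 + b ≡ R + (y + b) + 1
            rearrange = solve-∀
    dn-up′ : ∀ x y a b {R C K} → x + a ≡ R → y ≡ C + b → R + C + 1 ≡ K → x + y + 1 + a ≡ K + b
    dn-up′ x _ a b {C = C} refl refl refl = rearrange x a C b
      where rearrange : ∀ x a C b → x + (C + b) + 1 + a ≡ x + a + C + 1 + b
            rearrange = solve-∀
    dn-mid′ : ∀ x y a {R C K} → x + a ≡ R → y ≡ C → R + C + 1 ≡ K → x + y + 1 + a ≡ K
    dn-mid′ x _ a {C = C} refl refl refl = rearrange x a C
      where rearrange : ∀ x a C → x + C + 1 + a ≡ x + a + C + 1
            rearrange = solve-∀
    dn-dn′ : ∀ x y a b {R C K} → x + a ≡ R → y + b ≡ C → R + C + 1 ≡ K → x + y + 1 + (a + b) ≡ K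
    dn-dn′ x y a b refl refl refl = rearrange x y a b
      where rearrange : ∀ x y a b → x + y + 1 + (a + b) ≡ x + a + (y + b) + 1
            rearrange = solve-∀

  module _ {a b : Fin m → ℕ} (a-good : Good a) (b-good : Good b) (largest-sum : largest a + largest b + 1 ≡ centre) where
    opaque
      Sq : Matrix n
      Sq = OuterSum (embed a) (embed b)

      Sq≡OuterSum : ∀ i j → Sq i j ≡ OuterSum (embed a) (embed b) i j
      Sq≡OuterSum i j = refl

    up-up : ∀ k l → Sq (up k) (up l) ≡ centre + (a k + b l)
    up-up k l = trans (Sq≡OuterSum _ _) (up-up′ _ _ (a k) (b l) (embed-up a k) (embed-up b l) largest-sum)
    up-mid : ∀ k → Sq (up k) middle ≡ centre + a k
    up-mid k = trans (Sq≡OuterSum _ _) (up-mid′ _ _ (a k) (embed-up a k) (embed-mid b F.zero) largest-sum)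
    up-dn : ∀ k l → Sq (up k) (dn l) + b l ≡ centre + a k
    up-dn k l = trans (cong (_+ b l) (Sq≡OuterSum _ _))
                  (up-dn′ _ (embed b (dn l)) (a k) (b l) (embed-up a k) (embed-dn+a b-good l) largest-sum)
    mid-up : ∀ l → Sq middle (up l) ≡ centre + b l
    mid-up l = trans (Sq≡OuterSum _ _) (mid-up′ _ _ (b l) (embed-mid a F.zero) (embed-up b l) largest-sum)
    mid-mid : Sq middle middle ≡ centre
    mid-mid = trans (Sq≡OuterSum _ _) (trans (cong₂ (λ x y → x + y + 1) (embed-mid a F.zero) (embed-mid b F.zero)) largest-sum)
    mid-dn : ∀ l → Sq middle (dn l) + b l ≡ centre
    mid-dn l = trans (cong (_+ b l) (Sq≡OuterSum _ _))
                 (mid-dn′ _ (embed b (dn l)) (b l) (embed-mid a F.zero) (embed-dn+a b-good l) largest-sum)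
    dn-up : ∀ k l → Sq (dn k) (up l) + a k ≡ centre + b l
    dn-up k l = trans (cong (_+ a k) (Sq≡OuterSum _ _))
                  (dn-up′ (embed a (dn k)) _ (a k) (b l) (embed-dn+a a-good k) (embed-up b l) largest-sum)
    dn-mid : ∀ k → Sq (dn k) middle + a k ≡ centre
    dn-mid k = trans (cong (_+ a k) (Sq≡OuterSum _ _))
                 (dn-mid′ (embed a (dn k)) _ (a k) (embed-dn+a a-good k) (embed-mid b F.zero) largest-sum)
    dn-dn : ∀ k l → Sq (dn k) (dn l) + (a k + b l) ≡ centre
    dn-dn k l = trans (cong (_+ (a k + b l)) (Sq≡OuterSum _ _))
                  (dn-dn′ (embed a (dn k)) (embed b (dn l)) (a k) (b l) (embed-dn+a a-good k) (embed-dn+a b-good l) largest-sum)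

    Offset : ℕ → ℕ → Set
    Offset x o = InclSumDist a b o × (x ≡ centre + o ⊎ x + o ≡ centre)

    quadrant : ∀ i j → Sq i j ≡ centre ⊎ ∃[ o ] Offset (Sq i j) o
    quadrant i j = go (position i) (position j)
      where
      go : ∀ {i j} → Position i → Position j → Sq i j ≡ centre ⊎ ∃[ o ] Offset (Sq i j) o
      go (at-up k) (at-up l) = inj₂ (_ , inj₂ (inj₂ (k , l , inj₁ refl)) , inj₁ (up-up k l))
      go (at-up k) (at-mid F.zero) = inj₂ (_ , inj₁ (k , refl) , inj₁ (up-mid k))
      go (at-up k) (at-dn l) = inj₂ (_ , inj₂ (inj₂ (k , l , inj₂ refl)) , ∣-∣-shift centre _ (a k) (b l) (up-dn k l))
      go (at-mid F.zero) (at-up l) = inj₂ (_ , inj₂ (inj₁ (l , refl)) , inj₁ (mid-up l))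
      go (at-mid F.zero) (at-mid F.zero) = inj₁ mid-mid
      go (at-mid F.zero) (at-dn l) = inj₂ (_ , inj₂ (inj₁ (l , refl)) , inj₂ (mid-dn l))
      go (at-dn k) (at-up l) = inj₂ (_ , inj₂ (inj₂ (k , l , inj₂ refl)) ,
        subst (λ z → Sq (dn k) (up l) ≡ centre + z ⊎ Sq (dn k) (up l) + z ≡ centre)
              (NP.∣-∣-comm (b l) (a k)) (∣-∣-shift centre _ (b l) (a k) (dn-up k l)))
      go (at-dn k) (at-mid F.zero) = inj₂ (_ , inj₁ (k , refl) , inj₂ (dn-mid k))
      go (at-dn k) (at-dn l) = inj₂ (_ , inj₂ (inj₂ (k , l , inj₁ refl)) , inj₂ (dn-dn k l))

    value-above : ∀ o → InclSumDist a b o → ∃[ i ] ∃[ j ] Sq i j ≡ centre + o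
    value-above o (inj₁ (k , refl)) = up k , middle , up-mid k
    value-above o (inj₂ (inj₁ (l , refl))) = middle , up l , mid-up l
    value-above o (inj₂ (inj₂ (k , l , inj₁ refl))) = up k , up l , up-up k l
    value-above o (inj₂ (inj₂ (k , l , inj₂ e))) with ∣-∣≡⇒cases (a k) (b l) o (sym e)
    ... | inj₁ h = up k , dn l , above-shift centre _ (a k) (b l) o (up-dn k l) h
    ... | inj₂ h = dn k , up l , above-shift centre _ (b l) (a k) o (dn-up k l) h

    value-below : ∀ o → InclSumDist a b o → ∃[ i ] ∃[ j ] Sq i j + o ≡ centre
    value-below o (inj₁ (k , refl)) = dn k , middle , dn-mid k
    value-below o (inj₂ (inj₁ (l , refl))) = middle , dn l , mid-dn l
    value-below o (inj₂ (inj₂ (k , l , inj₁ refl))) = dn k , dn l , dn-dn k l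
    value-below o (inj₂ (inj₂ (k , l , inj₂ e))) with ∣-∣≡⇒cases (a k) (b l) o (sym e)
    ... | inj₁ h = dn k , up l , below-shift centre _ (a k) (b l) o (dn-up k l) h
    ... | inj₂ h = up k , dn l , below-shift centre _ (b l) (a k) o (up-dn k l) h

    sumDist⇒entries : (∀ v → InclSumDist a b v ⇔ Target v) → HasEntries Sq InRange
    sumDist⇒entries S v = mk⇔ to from
      where
      centre≤N : centre ≤ suc (T + T)
      centre≤N = s≤s (NP.m≤m+n T T)
      to : (∃[ i ] ∃[ j ] v ≡ Sq i j) → InRange v
      to (i , j , refl) with quadrant i j
      ... | inj₁ e = subst InRange (sym e) (s≤s z≤n , centre≤N)
      ... | inj₂ (o , sd , inj₁ e) = subst InRange (sym e) (s≤s z≤n , NP.+-monoʳ-≤ centre (proj₂ (Equivalence.to (S o) sd)))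
      ... | inj₂ (o , sd , inj₂ e) = positive (Sq i j) e , NP.≤-trans (subst (Sq i j ≤_) e (NP.m≤m+n _ o)) centre≤N
        where
        positive : ∀ x → x + o ≡ centre → 1 ≤ x
        positive zero o≡centre = ⊥-elim (NP.<-irrefl o≡centre (s≤s (proj₂ (Equivalence.to (S o) sd))))
        positive (suc _) _ = s≤s z≤n
      from : InRange v → ∃[ i ] ∃[ j ] v ≡ Sq i j
      from (1≤v , v≤N) with NP.<-cmp v centre
      ... | tri≈ _ v≡centre _ = middle , middle , trans v≡centre (sym mid-mid)
      ... | tri> _ _ K<v with value-above (v ∸ centre) (Equivalence.from (S _) (NP.m<n⇒0<n∸m K<v ,
                                NP.+-cancelˡ-≤ centre _ _ (subst (_≤ suc (T + T)) (sym (NP.m+[n∸m]≡n (NP.<⇒≤ K<v))) v≤N)))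
      ...   | i , j , e = i , j , trans (sym (NP.m+[n∸m]≡n (NP.<⇒≤ K<v))) (sym e)
      from (1≤v , v≤N) | tri< v<K _ _ with value-below (centre ∸ v) (Equivalence.from (S _) (NP.m<n⇒0<n∸m v<K , NP.∸-monoʳ-≤ centre 1≤v))
      ...   | i , j , e = i , j , NP.+-cancelʳ-≡ (centre ∸ v) _ _ (trans (trans (NP.+-comm v _) (NP.m∸n+n≡m (NP.<⇒≤ v<K))) (sym e))

    -- A distance |a_j − b_k| = 0 would make Sq (up j) (dn k) equal to Sq middle middle.
    sumDist-positive : (∀ i j i' j' → Sq i j ≡ Sq i' j' → i ≡ i') → ∀ {v} → InclSumDist a b v → 1 ≤ v
    sumDist-positive Sq-injective (inj₁ (k , refl)) = a-positive a-good k
    sumDist-positive Sq-injective (inj₂ (inj₁ (l , refl))) = a-positive b-good l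
    sumDist-positive Sq-injective (inj₂ (inj₂ (k , l , inj₁ refl))) = NP.≤-trans (a-positive a-good k) (NP.m≤m+n _ _)
    sumDist-positive Sq-injective {suc v} (inj₂ (inj₂ (k , l , inj₂ e))) = s≤s z≤n
    sumDist-positive Sq-injective {zero} (inj₂ (inj₂ (k , l , inj₂ e))) =
      ⊥-elim (FP.<⇒≢ (mid<up F.zero k) (sym (Sq-injective (up k) (dn l) middle middle (trans Sq≡centre (sym mid-mid)))))
      where
      Sq≡centre : Sq (up k) (dn l) ≡ centre
      Sq≡centre = NP.+-cancelʳ-≡ (b l) _ _ (trans (up-dn k l) (cong (centre +_) (NP.∣m-n∣≡0⇒m≡n (sym e))))

    entries⇒sumDist : HasEntries Sq InRange → (∀ i j i' j' → Sq i j ≡ Sq i' j' → i ≡ i') →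
                      ∀ v → InclSumDist a b v ⇔ Target v
    entries⇒sumDist E Sq-injective v = mk⇔ to from
      where
      to : InclSumDist a b v → Target v
      to sd with value-above v sd
      ... | i , j , e = sumDist-positive Sq-injective sd ,
                        NP.+-cancelˡ-≤ centre _ _ (subst (_≤ suc (T + T)) e (proj₂ (Equivalence.to (E _) (i , j , refl))))
      from : Target v → InclSumDist a b v
      from (1≤v , v≤T) with Equivalence.from (E (centre + v)) (s≤s z≤n , NP.+-monoʳ-≤ centre v≤T)
      ... | i , j , K+v≡ with quadrant i j
      ...   | inj₁ Sq≡centre = ⊥-elim (NP.<-irrefl v≡0 1≤v)
        where v≡0 : 0 ≡ v
              v≡0 = sym (NP.+-cancelˡ-≡ centre _ _ (trans (trans K+v≡ Sq≡centre) (sym (NP.+-identityʳ centre))))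
      ...   | inj₂ (o , sd , inj₁ e) = subst (InclSumDist a b) (sym (NP.+-cancelˡ-≡ centre _ _ (trans K+v≡ e))) sd
      ...   | inj₂ (o , sd , inj₂ e) = ⊥-elim (NP.<-irrefl (sym (NP.m+n≡0⇒m≡0 v v+o≡0)) 1≤v)
        where v+o≡0 : v + o ≡ 0
              v+o≡0 = NP.+-cancelˡ-≡ centre _ _ (trans (sym (NP.+-assoc centre v o))
                        (trans (cong (_+ o) K+v≡) (trans e (sym (NP.+-identityʳ centre)))))

module OddCase (p : ℕ) where
  open OddEmbedding p

  T : ℕ
  T = 2 * (m * (m + 1))

  open OddEntries p T

  n*n≡N : n * n ≡ suc (T + T)
  n*n≡N = rearrange p
    where rearrange : ∀ p → suc (2 * suc p) * suc (2 * suc p) ≡ suc (2 * (suc p * (suc p + 1)) + 2 * (suc p * (suc p + 1)))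
          rearrange = solve-∀

  open InclSADSys

  -- a_m + b_m is the largest value 2m(m+1) of the target.
  largest-sum : ∀ S → largest (a S) + largest (b S) + 1 ≡ centre
  largest-sum S = trans (NP.+-comm _ 1) (cong suc (NP.≤-antisym upper lower))
    where
    a≤ : ∀ j → a S j ≤ largest (a S)
    a≤ = increasing⇒≤last (a S) (proj₂ (a-inc S))
    b≤ : ∀ k → b S k ≤ largest (b S)
    b≤ = increasing⇒≤last (b S) (proj₂ (b-inc S))
    upper : largest (a S) + largest (b S) ≤ T
    upper = proj₂ (Equivalence.to (sad S _) (inj₂ (inj₂ (last , last , inj₁ refl))))
    lower : T ≤ largest (a S) + largest (b S)
    lower with Equivalence.from (sad S T) (s≤s z≤n , NP.≤-refl)
    ... | inj₁ (j , e) = subst (_≤ largest (a S) + largest (b S)) (sym e)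
                           (NP.≤-trans (a≤ j) (NP.m≤m+n (largest (a S)) (largest (b S))))
    ... | inj₂ (inj₁ (k , e)) = subst (_≤ largest (a S) + largest (b S)) (sym e)
                                  (NP.≤-trans (b≤ k) (NP.m≤n+m (largest (b S)) (largest (a S))))
    ... | inj₂ (inj₂ sd) = sumDist≤largest (proj₂ (a-inc S)) (proj₂ (b-inc S)) sd

  system-entries : ∀ S → HasEntries (OuterSum (embed (a S)) (embed (b S))) (λ v → 1 ≤ v × v ≤ n * n)
  system-entries S = subst (λ N → HasEntries (OuterSum (embed (a S)) (embed (b S))) (λ v → 1 ≤ v × v ≤ N)) (sym n*n≡N)
    (hasEntries-cong (Sq≡OuterSum (a-inc S) (b-inc S) (largest-sum S))
      (sumDist⇒entries (a-inc S) (b-inc S) (largest-sum S) (sad S)))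

  module FromRowSequence (f : Fin n → ℕ) (f-increasing : Increasing f) (f-i0 : f i0 ≡ 0)
                         (f-opposite-sum : ∀ i → f i + f (opposite i) ≡ f (opposite i0)) where
    fL fM : ℕ
    fL = f (opposite i0)
    fM = f middle

    fM+fM : fM + fM ≡ fL
    fM+fM = subst (λ j → fM + f j ≡ fL) (opposite-mid F.zero) (f-opposite-sum middle)

    up+dn : ∀ k → f (up k) + f (dn k) ≡ fL
    up+dn k = subst (λ j → f (up k) + f j ≡ fL) (opposite-up k) (f-opposite-sum (up k))

    M<up : ∀ k → fM < f (up k)
    M<up k = f-increasing middle (up k) (mid<up F.zero k)

    a′ : Fin m → ℕ
    a′ k = f (up k) ∸ fM

    fM+a′ : ∀ k → fM + a′ k ≡ f (up k)
    fM+a′ k = NP.m+[n∸m]≡n (NP.<⇒≤ (M<up k))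

    largest-a′ : largest a′ ≡ fM
    largest-a′ = trans (cong (_∸ fM) up-last) (NP.m+n∸m≡n fM fM)
      where up-last : f (up last) ≡ fM + fM
            up-last = trans (sym (NP.+-identityʳ _))
                        (trans (cong (f (up last) +_) (sym f-i0)) (trans (up+dn last) (sym fM+fM)))

    a′-good : Good a′
    a′-good = (λ k → NP.m<n⇒0<n∸m (M<up k)) ,
              (λ k k' lt → NP.+-cancelˡ-< fM _ _ (subst₂ _<_ (sym (fM+a′ k)) (sym (fM+a′ k'))
                 (f-increasing (up k) (up k') (up-mono lt))))

    a′+dn : ∀ k → a′ k + f (dn k) ≡ fM
    a′+dn k = NP.+-cancelˡ-≡ fM _ _ (trans (sym (NP.+-assoc fM (a′ k) _))
                (trans (cong (_+ f (dn k)) (fM+a′ k)) (trans (up+dn k) (sym fM+fM))))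

    embed-a′ : ∀ i → embed a′ i ≡ f i
    embed-a′ i = go (position i)
      where
      go : ∀ {i} → Position i → embed a′ i ≡ f i
      go (at-dn k) = trans (embed-dn a′ k) (trans (cong (_∸ a′ k) (trans largest-a′ (sym (a′+dn k))))
                       (NP.m+n∸m≡n (a′ k) (f (dn k))))
      go (at-mid F.zero) = trans (embed-mid a′ F.zero) largest-a′
      go (at-up k) = trans (embed-up a′ k) (trans (cong (_+ a′ k) largest-a′) (fM+a′ k))

  decode : ∀ (X : PrincipalRevSquare n) → Σ (InclSADSys m) λ S →
           embed (b S) i1 ≡ 1 × (∀ i j → OuterSum (embed (a S)) (embed (b S)) i j ≡ PrincipalRevSquare.M X i j)
  decode X = S , trans (C.embed-a′ i1) (cong (_∸ 1) (m12 i0 i1 toℕ-i0 toℕ-i1)) , X≡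
    where
    open Offsets X i0 toℕ-i0
    open PrincipalRevSquare X using (entries; m12)
    module R = FromRowSequence r r-increasing r-i0 r-opposite-sum
    module C = FromRowSequence c c-increasing c-i0 c-opposite-sum
    X≡ : ∀ i j → OuterSum (embed R.a′) (embed C.a′) i j ≡ PrincipalRevSquare.M X i j
    X≡ i j = trans (cong₂ (λ x y → x + y + 1) (R.embed-a′ i) (C.embed-a′ j)) (sym (M≡OuterSum i j))
    -- 2 (r_mid + c_mid) + 1 = r_L + c_L + 1 = n², so r_mid + c_mid = T.
    sum : largest R.a′ + largest C.a′ + 1 ≡ centre
    sum = trans (NP.+-comm _ 1) (cong suc (+-double-injective _ _ (NP.suc-injective
            (trans (rearrange (largest R.a′) (largest C.a′))
              (trans (cong₂ (λ x y → x + y + 1) (trans (cong₂ _+_ R.largest-a′ R.largest-a′) R.fM+fM)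
                                                 (trans (cong₂ _+_ C.largest-a′ C.largest-a′) C.fM+fM))
                (trans r+c-last n*n≡N))))))
      where rearrange : ∀ x y → suc ((x + y) + (x + y)) ≡ (x + x) + (y + y) + 1
            rearrange = solve-∀
    X≡Sq : ∀ i j → PrincipalRevSquare.M X i j ≡ Sq R.a′-good C.a′-good sum i j
    X≡Sq i j = trans (sym (X≡ i j)) (sym (Sq≡OuterSum R.a′-good C.a′-good sum i j))
    inRange : HasEntries (Sq R.a′-good C.a′-good sum) InRange
    inRange = hasEntries-cong X≡Sq (subst (λ N → HasEntries (PrincipalRevSquare.M X) (λ v → 1 ≤ v × v ≤ N)) n*n≡N entries)
    Sq-injective : ∀ i j i' j' → Sq R.a′-good C.a′-good sum i j ≡ Sq R.a′-good C.a′-good sum i' j' → i ≡ i'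
    Sq-injective i j i' j' e = proj₁ (entries-injective _ entries i j i' j' (trans (X≡Sq i j) (trans e (sym (X≡Sq i' j')))))
    S : InclSADSys m
    S = record { a = R.a′ ; b = C.a′ ; a-inc = R.a′-good ; b-inc = C.a′-good
               ; sad = entries⇒sumDist R.a′-good C.a′-good sum inRange Sq-injective }

  bijection : Bijection (InclSAD m) (PRS n)
  bijection = OuterSumBijection.bijection n m i0 i1 toℕ-i0 toℕ-i1 2≤n*n (InclSAD m) a b (λ e → e) (λ e → e)
                embed embed-cong embed-i0 Good a-inc b-inc embed-injective embed-increasing embed-sums
                system-entries decode

theorem31 : ∀ (m : ℕ) → 1 ≤ m →
    Bijection (NonInclSAD m) (PRS (2 * m)) × Bijection (InclSAD m) (PRS (suc (2 * m)))
theorem31 (suc p) _ = EvenCase.bijection p , OddCase.bijection p
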